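{- Suppose there exists a $(1,1;3)$-frame with group partition $\{G_1, G_2, \dots, G_m\}$. If there exists an $\mathrm{NR}^*\mathrm{DSTS}(|G_i|+1)$ for all $i = 1, \dots, m$, then there exists an $\mathrm{NR}^*\mathrm{DSTS}\bigl(\sum_{i=1}^m |G_i| + 1\bigr)$.
   Context: An $\mathrm{STS}(v)$ is a pair $(V,\mathcal{B})$ with $|V|=v$ and $\mathcal{B}$ a family of 3-subsets (blocks) such that every pair of distinct elements lies in exactly one block. A $\mathrm{DSTS}(v)$ is the block collection $2\mathcal{B}$ consisting of two (distinct, labeled) copies of each block of an $\mathrm{STS}(v)$. A near resolution is a partition of the blocks into classes such that each class consists of pairwise disjoint blocks covering $V$ minus exactly one element, and each element is missed by exactly one class. It is self-orthogonal if for any two distinct classes $R_i,R_j$, regarding classes as sets of 3-subsets, $|R_i\cap R_j|\le 1$. An $\mathrm{NR}^*\mathrm{DSTS}(v)$ is a $\mathrm{DSTS}(v)$ with a self-orthogonal near resolution. A $(1,1;3)$-frame with group partition $\{G_1,\dots,G_m\}$ of a $v$-set $V$ (with each $|G_i|$ even) is a square array $F$ of side $v/2$, rows and columns indexed by $0,1,\dots,v/2-1$, such that: (1) each cell is empty or contains a 3-subset of $V$; (2) with $t_i=|G_i|/2$, $g_k=\sum_{i\le k}t_i$, $g_0=0$, the $t_i\times t_i$ subsquare $F_i$ indexed by $g_{i-1},\dots,g_i-1$ (in both rows and columns) is empty for each $i$; (3) for $x\in\{g_{i-1},\dots,g_i-1\}$, row $x$ and column $x$ each contain every element of $V\setminus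 G_i$ exactly once; (4) the 3-subsets in the nonempty cells form a group divisible design with groups $G_1,\dots,G_m$, block size 3 and index 1, i.e., every block meets each group in at most one point and every pair of points from distinct groups lies in exactly one block. -}

module Defs where

open import Data.Nat using (ℕ; zero; suc; _+_; _*_)
open import Data.Nat.Divisibility using (_∣_)
open import Data.Nat.DivMod using (_/_)
open import Data.Fin using (Fin; toℕ; _≟_)
open import Data.Fin.Base using () renaming (_<_ to _<ᶠ_)
open import Data.List using (List; []; _∷_; length; lookup; filter; allFin; concatMap; _++_)
open import Data.List.Membership.Propositional using (_∈_)
open import Data.List.Relation.Binary.Permutation.Propositional using (_↭_)
open import Data.Maybe using (Maybe; just; nothing)
open import Data.Product using (Σ; _×_; ∃; ∃-syntax)
open import Data.Sum using (_⊎_)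
open import Data.Empty using (⊥)
open import Relation.Nullary using (¬_)
open import Relation.Binary.PropositionalEquality using (_≡_; _≢_)
import Data.Nat as ℕ

-- 3-subsets of Fin n, represented canonically as strictly increasing
-- triples (so two 3-subsets are equal iff they are ≡).

record Triple (n : ℕ) : Set where
  constructor triple
  field
    a b c : Fin n
    a<b   : a <ᶠ b
    b<c   : b <ᶠ c
open Triple public

_∈T_ : ∀ {n} → Fin n → Triple n → Set
x ∈T t = x ≡ a t ⊎ (x ≡ b t ⊎ x ≡ c t)

ExactlyOneBlock : ∀ {n} → List (Triple n) → Fin n → Fin n → Set
ExactlyOneBlock B x y =
  Σ (Fin (length B)) λ i →
    (x ∈T lookup B i × y ∈T lookup B i) ×
    (∀ j → x ∈T lookup B j → y ∈T lookup B j → j ≡ i)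

IsSTS : (v : ℕ) → List (Triple v) → Set
IsSTS v B = ∀ (x y : Fin v) → x ≢ y → ExactlyOneBlock B x y

IsNearParallelClass : ∀ {v} → Fin v → List (Triple v) → Set
IsNearParallelClass {v} x C =
  (∀ (i j : Fin (length C)) → i ≢ j → ∀ e → e ∈T lookup C i → e ∈T lookup C j → ⊥) ×
  (∀ t → t ∈ C → ¬ (x ∈T t)) ×
  (∀ (y : Fin v) → y ≢ x → ∃[ t ] (t ∈ C × y ∈T t))

-- NR*DSTS(v): an STS(v) with block list B, and a near resolution of the
-- doubled block collection 2B (two labelled copies of each block).
-- Since each point is missed by exactly one class, the classes are
-- indexed by the point they miss: class x = R x.
-- Partition of 2B: the concatenation of all classes is a permutation
-- (multiset equality) of B ++ B.

record NRStarDSTS (v : ℕ) : Set where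
  field
    blocks     : List (Triple v)
    isSTS      : IsSTS v blocks
    classes    : Fin v → List (Triple v)
    nearPar    : ∀ x → IsNearParallelClass x (classes x)
    partition  : concatMap classes (allFin v) ↭ (blocks ++ blocks)
    selfOrth   : ∀ (x y : Fin v) → x ≢ y → ∀ (t t' : Triple v) →
                 t ∈ classes x → t ∈ classes y →
                 t' ∈ classes x → t' ∈ classes y → t ≡ t'

-- Group partitions of Fin v into m (ordered) groups G_0,…,G_{m-1},
-- given by the group-assignment function grp : Fin v → Fin m
-- (G_i = grp⁻¹(i)).

gsize : ∀ {v m} → (Fin v → Fin m) → Fin m → ℕ
gsize {v} grp i = length (filter (λ x → grp x ≟ i) (allFin v))

pre : ∀ {m} → (Fin m → ℕ) → ℕ → ℕ
pre {zero}  t k       = 0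
pre {suc m} t zero    = 0
pre {suc m} t (suc k) = t Fin.zero + pre (λ j → t (Fin.suc j)) k
  where import Data.Fin as Fin

half : ∀ {v m} → (Fin v → Fin m) → Fin m → ℕ
half grp i = gsize grp i / 2

-- row/column index r lies in the band of group i:
-- g_{i} ≤ r < g_{i+1} (0-indexed groups, g_k = t_0 + … + t_{k-1})
InBand : ∀ {v m} → (Fin v → Fin m) → Fin m → ℕ → Set
InBand grp i r = pre (half grp) (toℕ i) ℕ.≤ r × r ℕ.< pre (half grp) (suc (toℕ i))

_∈C_ : ∀ {n} → Fin n → Maybe (Triple n) → Set
e ∈C c = ∃[ t ] (c ≡ just t × e ∈T t)

-- (1,1;3)-frames with group partition grp, as a square array of side v/2.

record Frame113 (v m : ℕ) (grp : Fin v → Fin m) : Set where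
  field
    groupsEven : ∀ i → 2 ∣ gsize grp i
    cell       : Fin (v / 2) → Fin (v / 2) → Maybe (Triple v)
    holesEmpty : ∀ i (r s : Fin (v / 2)) → InBand grp i (toℕ r) → InBand grp i (toℕ s) →
                 cell r s ≡ nothing
    rowProp    : ∀ i (r : Fin (v / 2)) → InBand grp i (toℕ r) → ∀ (e : Fin v) → grp e ≢ i →
                 Σ (Fin (v / 2)) λ s → e ∈C cell r s × (∀ s' → e ∈C cell r s' → s' ≡ s)
    colProp    : ∀ i (r : Fin (v / 2)) → InBand grp i (toℕ r) → ∀ (e : Fin v) → grp e ≢ i →
                 Σ (Fin (v / 2)) λ s → e ∈C cell s r × (∀ s' → e ∈C cell s' r → s' ≡ s)
    -- (4) the nonempty cells form a 3-GDD of index 1 with groups G_i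
    transversal : ∀ (r s : Fin (v / 2)) (t : Triple v) → cell r s ≡ just t →
                  grp (a t) ≢ grp (b t) × grp (a t) ≢ grp (c t) × grp (b t) ≢ grp (c t)
    pairOnce   : ∀ (x y : Fin v) → grp x ≢ grp y →
                 Σ (Fin (v / 2) × Fin (v / 2)) λ p →
                   (x ∈C cell (Data.Product.proj₁ p) (Data.Product.proj₂ p) ×
                    y ∈C cell (Data.Product.proj₁ p) (Data.Product.proj₂ p)) ×
                   (∀ q → x ∈C cell (Data.Product.proj₁ q) (Data.Product.proj₂ q) →
                          y ∈C cell (Data.Product.proj₁ q) (Data.Product.proj₂ q) → q ≡ p)

-- Add a point ∞ to V.  Around ∞ put a copy of the given NR*DSTS(|Gᵢ|+1) on
-- Gᵢ ∪ {∞} for every group, and add every cell of the frame as a block.  The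
-- class missing ∞ is the union of the small classes missing ∞; the class
-- missing the k-th point of Gᵢ is the small class missing it together with the
-- k-th of the 2tᵢ rows and columns through the hole Fᵢ (tᵢ = |Gᵢ|/2), each of
-- which partitions V ∖ Gᵢ.  Pairs inside a group lie in one small block, pairs across
-- groups in one cell.  Two classes share at most one block: two lines through
-- the same hole share no cell (the hole is empty), so within a group all common
-- blocks are small ones and small self-orthogonality applies; across groups
-- only lines can meet, and a row and a column meet in one cell.  That the
-- classes partition the doubled blocks is checked by counting multiplicities:
-- every small block lies in two small classes, every cell in its row and in
-- its column.

module Submission where

open import Defs
open import Data.Nat using (ℕ; zero; suc; _+_; _*_; _∸_; _≤_; _<_; z≤n; s≤s; _<?_)
open import Data.Nat.Properties
open import Data.Nat.ListAction using (sum)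
open import Data.Nat.DivMod using (_/_; m/n*n≡m; m*n/n≡m)
open import Data.Fin using (Fin; zero; suc; toℕ; fromℕ<) renaming (_<_ to _<ᶠ_; _≟_ to _≟ᶠ_)
import Data.Fin.Properties as Finₚ
open import Data.List using (List; []; _∷_; _++_; map; concatMap; tabulate; allFin; length; lookup; filter)
open import Data.List.Properties using (length-++; length-tabulate; map-++; map-concatMap)
open import Data.List.Relation.Unary.All as All using ([]; _∷_)
open import Data.List.Relation.Unary.Any using (here; there; index)
import Data.List.Relation.Unary.Any.Properties as Anyₚ
open import Data.List.Relation.Unary.AllPairs as AllPairs using (AllPairs; []; _∷_)
import Data.List.Relation.Unary.AllPairs.Properties as AllPairsₚ
import Data.List.Relation.Unary.All.Properties as Allₚ
open import Data.List.Relation.Binary.Subset.Propositional using (_⊆_)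
open import Data.List.Relation.Unary.Unique.Propositional using (Unique)
import Data.List.Relation.Unary.Unique.Propositional.Properties as Uniqueₚ
open import Data.List.Membership.Propositional using (_∈_)
open import Data.List.Membership.Propositional.Properties
open import Data.List.Relation.Binary.Permutation.Propositional
  using (_↭_; prep; ↭-sym) renaming (refl to ↭-refl; trans to ↭-trans; swap to ↭-swap)
import Data.List.Relation.Binary.Permutation.Propositional.Properties as ↭ₚ
open import Data.Product using (Σ; _×_; _,_; proj₁; proj₂; ∃-syntax; swap)
open import Data.Sum using (_⊎_; inj₁; inj₂)
open import Data.Empty using (⊥; ⊥-elim)
open import Data.Maybe using (Maybe; just; nothing)
open import Relation.Nullary using (¬_; Dec; yes; no; contradiction; _×-dec_)
open import Relation.Unary using (Decidable)
open import Relation.Binary using (DecidableEquality; Rel; Symmetric; _Preserves_⟶_; tri<; tri≈; tri>)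
open import Function using (_∘_; case_of_)
open import Relation.Binary.PropositionalEquality
  using (_≡_; _≢_; refl; sym; trans; cong; cong₂; subst; subst₂; module ≡-Reasoning)
open import Algebra.Properties.CommutativeSemigroup +-commutativeSemigroup using (interchange; x∙yz≈y∙xz)
open import Algebra.Properties.CommutativeMonoid.Sum +-0-commutativeMonoid
  using (sum-syntax; sum-cong-≗; ∑-distrib-+; ∑-comm; sum-replicate-zero) renaming (sum to ∑)

private variable
  A B : Set

-- Sums, lists and multiplicities

sum-map-tabulate : ∀ {n} (f : A → ℕ) (g : Fin n → A) → sum (map f (tabulate g)) ≡ ∑[ i < n ] f (g i)
sum-map-tabulate {n = zero}  f g = refl
sum-map-tabulate {n = suc n} f g = cong (f (g zero) +_) (sum-map-tabulate f (g ∘ suc))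

𝟙[_] : ∀ {P : Set} → Dec P → ℕ
𝟙[ yes _ ] = 1
𝟙[ no  _ ] = 0

∑-const-1 : ∀ n → ∑[ i < n ] 1 ≡ n
∑-const-1 zero    = refl
∑-const-1 (suc n) = cong suc (∑-const-1 n)

∑-single : ∀ {n} (f : Fin n → ℕ) i → (∀ j → j ≢ i → f j ≡ 0) → ∑ f ≡ f i
∑-single {suc n} f zero    f≡0 = begin
  f zero + ∑[ j < n ] f (suc j) ≡⟨ cong (f zero +_) (sum-cong-≗ (λ j → f≡0 (suc j) λ ())) ⟩
  f zero + ∑[ j < n ] 0         ≡⟨ cong (f zero +_) (sum-replicate-zero n) ⟩
  f zero + 0                    ≡⟨ +-identityʳ (f zero) ⟩
  f zero                        ∎
  where open ≡-Reasoning
∑-single {suc n} f (suc i) f≡0 = begin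
  f zero + ∑[ j < n ] f (suc j) ≡⟨ cong (_+ ∑[ j < n ] f (suc j)) (f≡0 zero λ ()) ⟩
  ∑[ j < n ] f (suc j)          ≡⟨ ∑-single (λ j → f (suc j)) i (λ j j≢i → f≡0 (suc j) λ e → j≢i (Finₚ.suc-injective e)) ⟩
  f (suc i)                     ∎
  where open ≡-Reasoning

sum-map-lookup : ∀ (f : A → ℕ) xs → sum (map f xs) ≡ ∑[ k < length xs ] f (lookup xs k)
sum-map-lookup f []       = refl
sum-map-lookup f (x ∷ xs) = cong (f x +_) (sum-map-lookup f xs)

∑-filter : ∀ {n} {P : A → Set} (P? : Decidable P) (f : A → ℕ) (g : Fin n → A) →
  ∑[ j < n ] (𝟙[ P? (g j) ] * f (g j)) ≡ sum (map f (filter P? (tabulate g)))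
∑-filter {n = zero}  P? f g = refl
∑-filter {n = suc n} P? f g with P? (g zero)
... | yes _ = cong₂ _+_ (+-identityʳ (f (g zero))) (∑-filter P? f (g ∘ suc))
... | no  _ = ∑-filter P? f (g ∘ suc)

extendℕ : ∀ {n} → (Fin n → List A) → ℕ → List A
extendℕ {n = n} f k with k <? n
... | yes k<n = f (fromℕ< k<n)
... | no  _   = []

extendℕ-toℕ : ∀ {n} (f : Fin n → List A) i → extendℕ f (toℕ i) ≡ f i
extendℕ-toℕ {n = n} f i with toℕ i <? n
... | yes i<n = cong f (Finₚ.fromℕ<-toℕ i i<n)
... | no  i≮n = contradiction (Finₚ.toℕ<n i) i≮n

∈-concatMap-allFin⁻ : ∀ {n} (f : Fin n → List A) {y} → y ∈ concatMap f (allFin n) → ∃[ i ] y ∈ f i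
∈-concatMap-allFin⁻ f = Anyₚ.tabulate⁻ ∘ ∈-concatMap⁻ f

∈-concatMap-allFin⁺ : ∀ {n} (f : Fin n → List A) {y} i → y ∈ f i → y ∈ concatMap f (allFin n)
∈-concatMap-allFin⁺ f i = ∈-concatMap⁺ f ∘ Anyₚ.tabulate⁺ i

length-concatMap-tabulate : ∀ {n} (f : A → List B) (g : Fin n → A) →
  length (concatMap f (tabulate g)) ≡ ∑[ i < n ] length (f (g i))
length-concatMap-tabulate {n = zero}  f g = refl
length-concatMap-tabulate {n = suc n} f g =
  trans (length-++ (f (g zero))) (cong (length (f (g zero)) +_) (length-concatMap-tabulate f (g ∘ suc)))

Unique-⊆⇒length≤ : ∀ {xs ys : List A} → Unique xs → xs ⊆ ys → length xs ≤ length ys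
Unique-⊆⇒length≤ {xs = []}     _          _    = z≤n
Unique-⊆⇒length≤ {xs = x ∷ xs} (x∉xs ∷ u) xs⊆ys with ys₁ , ys₂ , refl ← ∈-∃++ (xs⊆ys (here refl)) =
  subst (suc (length xs) ≤_) (sym (↭ₚ.↭-length (↭ₚ.shift x ys₁ ys₂)))
        (s≤s (Unique-⊆⇒length≤ u (λ z∈xs → ∈-remove (xs⊆ys (there z∈xs)) (All.lookup x∉xs z∈xs))))
  where
  ∈-remove : ∀ {z} → z ∈ ys₁ ++ x ∷ ys₂ → x ≢ z → z ∈ ys₁ ++ ys₂
  ∈-remove z∈ x≢z with ∈-++⁻ ys₁ z∈
  ... | inj₁ z∈ys₁         = ∈-++⁺ˡ z∈ys₁
  ... | inj₂ (here refl)   = contradiction refl x≢z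
  ... | inj₂ (there z∈ys₂) = ∈-++⁺ʳ ys₁ z∈ys₂

module _ {ℓ} {R : Rel A ℓ} where

  AllPairs-++⁺ : ∀ {xs ys} → AllPairs R xs → AllPairs R ys → (∀ {x y} → x ∈ xs → y ∈ ys → R x y) →
                 AllPairs R (xs ++ ys)
  AllPairs-++⁺ Rxs Rys Rxys = AllPairsₚ.++⁺ Rxs Rys (All.tabulate λ x∈ → All.tabulate (Rxys x∈))

  AllPairs-concatMap-allFin⁺ : ∀ {n} {f : Fin n → List A} → (∀ i → AllPairs R (f i)) →
    (∀ {i j} → i <ᶠ j → ∀ {x y} → x ∈ f i → y ∈ f j → R x y) → AllPairs R (concatMap f (allFin n))
  AllPairs-concatMap-allFin⁺ Rf Rfij = AllPairsₚ.concat⁺ (Allₚ.map⁺ (Allₚ.tabulate⁺ Rf))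
    (AllPairsₚ.map⁺ (AllPairsₚ.tabulate⁺-< λ i<j → All.tabulate λ x∈ → All.tabulate (Rfij i<j x∈)))

  AllPairs-lookup< : ∀ {xs} → AllPairs R xs → ∀ {i j} → i <ᶠ j → R (lookup xs i) (lookup xs j)
  AllPairs-lookup< (Rx ∷ _)   {zero}  {suc j} _         = All.lookup Rx (∈-lookup j)
  AllPairs-lookup< (_ ∷ Rxs)  {suc i} {suc j} (s≤s i<j) = AllPairs-lookup< Rxs i<j

  AllPairs-lookup : Symmetric R → ∀ {xs} → AllPairs R xs → ∀ i j → i ≢ j → R (lookup xs i) (lookup xs j)
  AllPairs-lookup R-sym Rxs i j i≢j with Finₚ.<-cmp i j
  ... | tri< i<j _ _ = AllPairs-lookup< Rxs i<j
  ... | tri≈ _ i≡j _ = contradiction i≡j i≢j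
  ... | tri> _ _ j<i = R-sym (AllPairs-lookup< Rxs j<i)

  lookup⇒AllPairs : ∀ xs → (∀ i j → i ≢ j → R (lookup xs i) (lookup xs j)) → AllPairs R xs
  lookup⇒AllPairs []       _    = []
  lookup⇒AllPairs (x ∷ xs) Rij =
    All.tabulate (λ y∈ → subst (R x) (sym (Anyₚ.lookup-index y∈)) (Rij zero (suc (index y∈)) λ ())) ∷
    lookup⇒AllPairs xs (λ i j i≢j → Rij (suc i) (suc j) (i≢j ∘ Finₚ.suc-injective))

module Multiplicity (_≟_ : DecidableEquality A) where

  δ : A → A → ℕ
  δ x y = 𝟙[ x ≟ y ]

  count : A → List A → ℕ
  count x []       = 0
  count x (y ∷ ys) = δ x y + count x ys

  δ-refl : ∀ x → δ x x ≡ 1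
  δ-refl x with x ≟ x
  ... | yes _   = refl
  ... | no  x≢x = contradiction refl x≢x

  count-++ : ∀ x xs ys → count x (xs ++ ys) ≡ count x xs + count x ys
  count-++ x []       ys = refl
  count-++ x (y ∷ xs) ys = trans (cong (δ x y +_) (count-++ x xs ys)) (sym (+-assoc (δ x y) _ _))

  count-concatMap-tabulate : ∀ {n} x (f : B → List A) (g : Fin n → B) →
    count x (concatMap f (tabulate g)) ≡ ∑[ i < n ] count x (f (g i))
  count-concatMap-tabulate {n = zero}  x f g = refl
  count-concatMap-tabulate {n = suc n} x f g =
    trans (count-++ x (f (g zero)) _) (cong (count x (f (g zero)) +_) (count-concatMap-tabulate x f (g ∘ suc)))

  count-↭ : ∀ x {xs ys} → xs ↭ ys → count x xs ≡ count x ys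
  count-↭ x ↭-refl              = refl
  count-↭ x (prep y p)          = cong (δ x y +_) (count-↭ x p)
  count-↭ x (↭-swap y z p)      = trans (x∙yz≈y∙xz (δ x y) (δ x z) _) (cong (λ c → δ x z + (δ x y + c)) (count-↭ x p))
  count-↭ x (↭-trans p q)       = trans (count-↭ x p) (count-↭ x q)

  count>0⇒∈ : ∀ x ys → 0 < count x ys → x ∈ ys
  count>0⇒∈ x (y ∷ ys) c>0 with x ≟ y
  ... | yes x≡y = here x≡y
  ... | no  _   = there (count>0⇒∈ x ys c>0)

  count-≗⇒↭ : ∀ xs ys → (∀ x → count x xs ≡ count x ys) → xs ↭ ys
  count-≗⇒↭ []       []       _ = ↭-refl
  count-≗⇒↭ []       (y ∷ ys) c≗ = contradiction (trans (c≗ y) (cong (_+ count y ys) (δ-refl y))) 0≢1+n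
  count-≗⇒↭ (x ∷ xs) ys       c≗
    with ys₁ , ys₂ , refl ← ∈-∃++ (count>0⇒∈ x ys (subst (0 <_) (trans (cong (_+ count x xs) (sym (δ-refl x))) (c≗ x)) (s≤s z≤n)))
    = ↭-trans (prep x (count-≗⇒↭ xs (ys₁ ++ ys₂) c≗′)) (↭-sym (↭ₚ.shift x ys₁ ys₂))
    where
    c≗′ : ∀ z → count z xs ≡ count z (ys₁ ++ ys₂)
    c≗′ z = +-cancelˡ-≡ (δ z x) _ _ (trans (c≗ z) (count-↭ z (↭ₚ.shift x ys₁ ys₂)))

-- Triples

module _ {n : ℕ} where

  triple-≡ : ∀ {t t' : Triple n} → a t ≡ a t' → b t ≡ b t' → c t ≡ c t' → t ≡ t'
  triple-≡ {triple x y z _ _} {triple _ _ _ _ _} refl refl refl = cong₂ (triple x y z) (<-irrelevant _ _) (<-irrelevant _ _)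

  _≟T_ : DecidableEquality (Triple n)
  t ≟T t' with a t ≟ᶠ a t' | b t ≟ᶠ b t' | c t ≟ᶠ c t'
  ... | yes a≡ | yes b≡ | yes c≡ = yes (triple-≡ a≡ b≡ c≡)
  ... | no  a≢ | _      | _      = no (a≢ ∘ cong a)
  ... | yes _  | no  b≢ | _      = no (b≢ ∘ cong b)
  ... | yes _  | yes _  | no  c≢ = no (c≢ ∘ cong c)

  b≢c : ∀ (t : Triple n) → b t ≢ c t
  b≢c t = Finₚ.<⇒≢ (b<c t)

  Transversal : (Fin n → B) → Triple n → Set
  Transversal φ t = φ (a t) ≢ φ (b t) × φ (a t) ≢ φ (c t) × φ (b t) ≢ φ (c t)

  Transversal-≢ : ∀ {φ : Fin n → B} {t x y} → Transversal φ t → x ∈T t → y ∈T t → x ≢ y → φ x ≢ φ y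
  Transversal-≢ _               (inj₁ refl)        (inj₁ refl)        x≢y = contradiction refl x≢y
  Transversal-≢ (ab , _  , _ )  (inj₁ refl)        (inj₂ (inj₁ refl)) _   = ab
  Transversal-≢ (_  , ac , _ )  (inj₁ refl)        (inj₂ (inj₂ refl)) _   = ac
  Transversal-≢ (ab , _  , _ )  (inj₂ (inj₁ refl)) (inj₁ refl)        _   = ab ∘ sym
  Transversal-≢ _               (inj₂ (inj₁ refl)) (inj₂ (inj₁ refl)) x≢y = contradiction refl x≢y
  Transversal-≢ (_  , _  , bc)  (inj₂ (inj₁ refl)) (inj₂ (inj₂ refl)) _   = bc
  Transversal-≢ (_  , ac , _ )  (inj₂ (inj₂ refl)) (inj₁ refl)        _   = ac ∘ sym
  Transversal-≢ (_  , _  , bc)  (inj₂ (inj₂ refl)) (inj₂ (inj₁ refl)) _   = bc ∘ sym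
  Transversal-≢ _               (inj₂ (inj₂ refl)) (inj₂ (inj₂ refl)) x≢y = contradiction refl x≢y

  Transversal-id : ∀ (t : Triple n) → Transversal (λ x → x) t
  Transversal-id t = Finₚ.<⇒≢ (a<b t) , Finₚ.<⇒≢ (<-trans (a<b t) (b<c t)) , b≢c t

  others : ∀ (t : Triple n) {e} → e ∈T t → List (Fin n)
  others t (inj₁ _)        = b t ∷ c t ∷ []
  others t (inj₂ (inj₁ _)) = a t ∷ c t ∷ []
  others t (inj₂ (inj₂ _)) = a t ∷ b t ∷ []

  others-length : ∀ (t : Triple n) {e} (e∈t : e ∈T t) → length (others t e∈t) ≡ 2
  others-length t (inj₁ _)        = refl
  others-length t (inj₂ (inj₁ _)) = refl
  others-length t (inj₂ (inj₂ _)) = refl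

  others-∈ : ∀ (t : Triple n) {e x} (e∈t : e ∈T t) → x ∈ others t e∈t → x ∈T t × x ≢ e
  others-∈ t (inj₁ refl)        (here refl)         = inj₂ (inj₁ refl) , proj₁ (Transversal-id t) ∘ sym
  others-∈ t (inj₁ refl)        (there (here refl)) = inj₂ (inj₂ refl) , proj₁ (proj₂ (Transversal-id t)) ∘ sym
  others-∈ t (inj₂ (inj₁ refl)) (here refl)         = inj₁ refl , proj₁ (Transversal-id t)
  others-∈ t (inj₂ (inj₁ refl)) (there (here refl)) = inj₂ (inj₂ refl) , b≢c t ∘ sym
  others-∈ t (inj₂ (inj₂ refl)) (here refl)         = inj₁ refl , proj₁ (proj₂ (Transversal-id t))
  others-∈ t (inj₂ (inj₂ refl)) (there (here refl)) = inj₂ (inj₁ refl) , b≢c t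

  others-Unique : ∀ (t : Triple n) {e} (e∈t : e ∈T t) → Unique (others t e∈t)
  others-Unique t (inj₁ _)        = (b≢c t ∷ []) ∷ [] ∷ []
  others-Unique t (inj₂ (inj₁ _)) = (proj₁ (proj₂ (Transversal-id t)) ∷ []) ∷ [] ∷ []
  others-Unique t (inj₂ (inj₂ _)) = (proj₁ (Transversal-id t) ∷ []) ∷ [] ∷ []

  Disjoint : Triple n → Triple n → Set
  Disjoint t t' = ∀ e → e ∈T t → e ∈T t' → ⊥

  Disjoint-sym : Symmetric Disjoint
  Disjoint-sym d e e∈t' e∈t = d e e∈t e∈t'

module _ {n k : ℕ} (f : Fin n → Fin k) (f-mono : f Preserves _<ᶠ_ ⟶ _<ᶠ_) where

  mono⇒injective : ∀ {x y} → f x ≡ f y → x ≡ y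
  mono⇒injective {x} {y} fx≡fy with Finₚ.<-cmp x y
  ... | tri< x<y _ _ = contradiction fx≡fy (Finₚ.<⇒≢ (f-mono x<y))
  ... | tri≈ _ x≡y _ = x≡y
  ... | tri> _ _ y<x = contradiction (sym fx≡fy) (Finₚ.<⇒≢ (f-mono y<x))

  mapT : Triple n → Triple k
  mapT t = triple (f (a t)) (f (b t)) (f (c t)) (f-mono (a<b t)) (f-mono (b<c t))

  mapT-injective : ∀ {t t'} → mapT t ≡ mapT t' → t ≡ t'
  mapT-injective eq = triple-≡ (mono⇒injective (cong a eq)) (mono⇒injective (cong b eq)) (mono⇒injective (cong c eq))

  ∈-mapT⁺ : ∀ {t p} → p ∈T t → f p ∈T mapT t
  ∈-mapT⁺ (inj₁ refl)        = inj₁ refl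
  ∈-mapT⁺ (inj₂ (inj₁ refl)) = inj₂ (inj₁ refl)
  ∈-mapT⁺ (inj₂ (inj₂ refl)) = inj₂ (inj₂ refl)

  ∈-mapT⁻ : ∀ {t e} → e ∈T mapT t → ∃[ p ] (p ∈T t × e ≡ f p)
  ∈-mapT⁻ {t} (inj₁ refl)        = a t , inj₁ refl , refl
  ∈-mapT⁻ {t} (inj₂ (inj₁ refl)) = b t , inj₂ (inj₁ refl) , refl
  ∈-mapT⁻ {t} (inj₂ (inj₂ refl)) = c t , inj₂ (inj₂ refl) , refl

  ∈-mapT-reflect : ∀ {t p} → f p ∈T mapT t → p ∈T t
  ∈-mapT-reflect {t} fp∈ with p , p∈t , fp≡ ← ∈-mapT⁻ {t} fp∈ rewrite mono⇒injective fp≡ = p∈t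

  mapT-Disjoint : ∀ {t t'} → Disjoint t t' → Disjoint (mapT t) (mapT t')
  mapT-Disjoint {t} {t'} d e e∈ e∈' with p , p∈ , refl ← ∈-mapT⁻ {t} e∈ | p' , p∈' , e≡ ← ∈-mapT⁻ {t'} e∈'
    rewrite mono⇒injective e≡ = d p' p∈ p∈'

sucT : ∀ {n} → Triple n → Triple (suc n)
sucT = mapT suc s≤s

module _ {v : ℕ} where

  sucT-injective : ∀ {t t' : Triple v} → sucT t ≡ sucT t' → t ≡ t'
  sucT-injective = mapT-injective suc s≤s

  liftCell : Maybe (Triple v) → List (Triple (suc v))
  liftCell nothing   = []
  liftCell (just t₀) = sucT t₀ ∷ []

  ∈-liftCell⁻ : ∀ c {t₁} → t₁ ∈ liftCell c → ∃[ t₀ ] (c ≡ just t₀ × t₁ ≡ sucT t₀)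
  ∈-liftCell⁻ (just t₀) (here t₁≡) = t₀ , refl , t₁≡

  liftCell-AllPairs : ∀ {ℓ} {R : Rel (Triple (suc v)) ℓ} c → AllPairs R (liftCell c)
  liftCell-AllPairs nothing  = []
  liftCell-AllPairs (just _) = [] ∷ []

-- Steiner triple systems and near-parallel classes

module _ {n : ℕ} {B : List (Triple n)} where

  ∈-lookup-index : ∀ {x t} (t∈B : t ∈ B) → x ∈T t → x ∈T lookup B (index t∈B)
  ∈-lookup-index t∈B = subst (_ ∈T_) (Anyₚ.lookup-index t∈B)

  IsSTS-block-unique : IsSTS n B → ∀ {t t' x y} → t ∈ B → t' ∈ B → x ≢ y →
    x ∈T t → y ∈T t → x ∈T t' → y ∈T t' → t ≡ t'
  IsSTS-block-unique sts {t} {t'} {x} {y} t∈B t'∈B x≢y x∈t y∈t x∈t' y∈t' = begin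
    t                       ≡⟨ Anyₚ.lookup-index t∈B ⟩
    lookup B (index t∈B)    ≡⟨ cong (lookup B) (trans (unique _ (∈-lookup-index t∈B x∈t) (∈-lookup-index t∈B y∈t))
                                                 (sym (unique _ (∈-lookup-index t'∈B x∈t') (∈-lookup-index t'∈B y∈t')))) ⟩
    lookup B (index t'∈B)   ≡⟨ Anyₚ.lookup-index t'∈B ⟨
    t'                      ∎
    where
    open ≡-Reasoning
    unique = proj₂ (proj₂ (sts x y x≢y))

  IsSTS⇒Unique : IsSTS n B → Unique B
  IsSTS⇒Unique sts = lookup⇒AllPairs B λ i j i≢j Bᵢ≡Bⱼ →
    let tᵢ = lookup B i
        unique = proj₂ (proj₂ (sts (a tᵢ) (b tᵢ) (proj₁ (Transversal-id tᵢ))))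
    in i≢j (trans (unique i (inj₁ refl) (inj₂ (inj₁ refl)))
                  (sym (unique j (subst (a tᵢ ∈T_) Bᵢ≡Bⱼ (inj₁ refl)) (subst (b tᵢ ∈T_) Bᵢ≡Bⱼ (inj₂ (inj₁ refl))))))

  Unique⇒ExactlyOneBlock : Unique B → ∀ {x y t} →
    (∀ {t₁ t₂} → t₁ ∈ B → t₂ ∈ B → x ∈T t₁ → y ∈T t₁ → x ∈T t₂ → y ∈T t₂ → t₁ ≡ t₂) →
    t ∈ B → x ∈T t → y ∈T t → ExactlyOneBlock B x y
  Unique⇒ExactlyOneBlock uniq block-unique t∈B x∈t y∈t =
    index t∈B , (∈-lookup-index t∈B x∈t , ∈-lookup-index t∈B y∈t) , only
    where
    only : ∀ j → _ ∈T lookup B j → _ ∈T lookup B j → j ≡ index t∈B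
    only j x∈ y∈ with j ≟ᶠ index t∈B
    ... | yes j≡ = j≡
    ... | no  j≢ = contradiction
      (block-unique (∈-lookup j) (∈-lookup (index t∈B)) x∈ y∈ (∈-lookup-index t∈B x∈t) (∈-lookup-index t∈B y∈t))
      (AllPairs-lookup (λ ne → ne ∘ sym) uniq j (index t∈B) j≢)

nearParallel : ∀ {n} {x : Fin n} {C} → AllPairs Disjoint C → (∀ t → t ∈ C → ¬ (x ∈T t)) →
  (∀ y → y ≢ x → ∃[ t ] (t ∈ C × y ∈T t)) → IsNearParallelClass x C
nearParallel disjoint misses covers = AllPairs-lookup (λ {t} {t'} → Disjoint-sym {x = t} {t'}) disjoint , misses , covers

-- Prefix sums and bands

pre-zero : ∀ {m} (t : Fin m → ℕ) → pre t 0 ≡ 0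
pre-zero {zero}  t = refl
pre-zero {suc m} t = refl

pre-suc : ∀ {m} (t : Fin m → ℕ) i → pre t (suc (toℕ i)) ≡ pre t (toℕ i) + t i
pre-suc t zero    = trans (cong (t zero +_) (pre-zero (t ∘ suc))) (+-comm (t zero) 0)
pre-suc t (suc i) = trans (cong (t zero +_) (pre-suc (t ∘ suc) i)) (sym (+-assoc (t zero) _ _))

pre-mono : ∀ {m} (t : Fin m → ℕ) {k k'} → k ≤ k' → pre t k ≤ pre t k'
pre-mono {zero}  t _           = z≤n
pre-mono {suc m} t {zero}  _   = z≤n
pre-mono {suc m} t {suc k} {suc k'} (s≤s k≤k') = +-monoʳ-≤ (t zero) (pre-mono (t ∘ suc) k≤k')

pre≤∑ : ∀ {m} (t : Fin m → ℕ) k → pre t k ≤ ∑ t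
pre≤∑ {zero}  t _       = z≤n
pre≤∑ {suc m} t zero    = z≤n
pre≤∑ {suc m} t (suc k) = +-monoʳ-≤ (t zero) (pre≤∑ (t ∘ suc) k)

-- InBand grp is Band (half grp) by definition.
Band : ∀ {m} → (Fin m → ℕ) → Fin m → ℕ → Set
Band t i r = pre t (toℕ i) ≤ r × r < pre t (suc (toℕ i))

Band? : ∀ {m} (t : Fin m → ℕ) i r → Dec (Band t i r)
Band? t i r = (pre t (toℕ i) ≤? r) ×-dec (r <? pre t (suc (toℕ i)))

Band-unique : ∀ {m} (t : Fin m → ℕ) {i j r} → Band t i r → Band t j r → i ≡ j
Band-unique t {i} {j} (lo , hi) (lo' , hi') with <-cmp (toℕ i) (toℕ j)
... | tri< i<j _ _ = contradiction (<-≤-trans hi (≤-trans (pre-mono t i<j) lo')) (<-irrefl refl)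
... | tri≈ _ i≡j _ = Finₚ.toℕ-injective i≡j
... | tri> _ _ j<i = contradiction (<-≤-trans hi' (≤-trans (pre-mono t j<i) lo)) (<-irrefl refl)

Band-offset : ∀ {m} (t : Fin m → ℕ) i {k} → k < t i → Band t i (pre t (toℕ i) + k)
Band-offset t i {k} k<tᵢ = m≤m+n _ _ , subst (pre t (toℕ i) + k <_) (sym (pre-suc t i)) (+-monoʳ-< (pre t (toℕ i)) k<tᵢ)

Band-exists : ∀ {m} (t : Fin m → ℕ) {r} → r < ∑ t → ∃[ i ] Band t i r
Band-exists {suc m} t {r} r<∑ with r <? t zero
... | yes r<t₀ = zero , z≤n , subst (r <_) (sym (pre-suc t zero)) r<t₀
... | no  r≮t₀ = suc i , subst (Band t (suc i)) r≡ (+-monoʳ-≤ (t zero) lo , +-monoʳ-< (t zero) hi)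
  where
  r≡ : t zero + (r ∸ t zero) ≡ r
  r≡ = m+[n∸m]≡n (≮⇒≥ r≮t₀)
  rec = Band-exists (t ∘ suc) (+-cancelˡ-< (t zero) _ _ (subst (_< ∑ t) (sym r≡) r<∑))
  i  = proj₁ rec
  lo = proj₁ (proj₂ rec)
  hi = proj₂ (proj₂ rec)

∑-split : ∀ p q (h : ℕ → ℕ) → ∑[ k < p + q ] h (toℕ k) ≡ ∑[ k < p ] h (toℕ k) + ∑[ k < q ] h (p + toℕ k)
∑-split zero    q h = refl
∑-split (suc p) q h = trans (cong (h 0 +_) (∑-split p q (h ∘ suc))) (sym (+-assoc (h 0) _ _))

∑-bands : ∀ {m} (t : Fin m → ℕ) (h : ℕ → ℕ) →
  ∑[ r < ∑ t ] h (toℕ r) ≡ ∑[ i < m ] ∑[ k < t i ] h (pre t (toℕ i) + toℕ k)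
∑-bands {zero}  t h = refl
∑-bands {suc m} t h = begin
  ∑[ r < ∑ t ] h (toℕ r)
    ≡⟨ ∑-split (t zero) (∑ (t ∘ suc)) h ⟩
  ∑[ k < t zero ] h (toℕ k) + ∑[ r < ∑ (t ∘ suc) ] h (t zero + toℕ r)
    ≡⟨ cong (∑[ k < t zero ] h (toℕ k) +_) (∑-bands (t ∘ suc) (λ r → h (t zero + r))) ⟩
  ∑[ k < t zero ] h (toℕ k) + ∑[ i < m ] ∑[ k < t (suc i) ] h (t zero + (pre (t ∘ suc) (toℕ i) + toℕ k))
    ≡⟨ cong (∑[ k < t zero ] h (toℕ k) +_) (sum-cong-≗ {m} λ i → sum-cong-≗ {t (suc i)} λ k →
         cong h (sym (+-assoc (t zero) (pre (t ∘ suc) (toℕ i)) (toℕ k)))) ⟩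
  ∑[ k < t zero ] h (toℕ k) + ∑[ i < m ] ∑[ k < t (suc i) ] h (pre t (suc (toℕ i)) + toℕ k)
    ∎
  where open ≡-Reasoning

Band-size : ∀ {m} (t : Fin m → ℕ) i → ∑[ r < ∑ t ] 𝟙[ Band? t i (toℕ r) ] ≡ t i
Band-size {m} t i = begin
  ∑[ r < ∑ t ] 𝟙 (toℕ r)                                    ≡⟨ ∑-bands t 𝟙 ⟩
  ∑[ j < m ] ∑[ k < t j ] 𝟙 (pre t (toℕ j) + toℕ k)          ≡⟨ ∑-single _ i outside ⟩
  ∑[ k < t i ] 𝟙 (pre t (toℕ i) + toℕ k)                    ≡⟨ sum-cong-≗ inside ⟩
  ∑[ k < t i ] 1                                            ≡⟨ ∑-const-1 (t i) ⟩
  t i                                                       ∎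
  where
  open ≡-Reasoning
  𝟙 : ℕ → ℕ
  𝟙 r = 𝟙[ Band? t i r ]
  inside : ∀ (k : Fin (t i)) → 𝟙 (pre t (toℕ i) + toℕ k) ≡ 1
  inside k with Band? t i (pre t (toℕ i) + toℕ k)
  ... | yes _ = refl
  ... | no ¬b = contradiction (Band-offset t i (Finₚ.toℕ<n k)) ¬b
  outside-term : ∀ j → j ≢ i → ∀ (k : Fin (t j)) → 𝟙 (pre t (toℕ j) + toℕ k) ≡ 0
  outside-term j j≢i k with Band? t i (pre t (toℕ j) + toℕ k)
  ... | yes b = contradiction (Band-unique t (Band-offset t j (Finₚ.toℕ<n k)) b) j≢i
  ... | no  _ = refl
  outside : ∀ j → j ≢ i → ∑[ k < t j ] 𝟙 (pre t (toℕ j) + toℕ k) ≡ 0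
  outside j j≢i = trans (sum-cong-≗ (outside-term j j≢i)) (sum-replicate-zero (t j))

-- Groups

module GroupEnumeration {v m : ℕ} (grp : Fin v → Fin m) where

  members : Fin m → List (Fin v)
  members i = filter (λ x → grp x ≟ᶠ i) (allFin v)

  member : ∀ i → Fin (gsize grp i) → Fin v
  member i = lookup (members i)

  member-grp : ∀ i k → grp (member i k) ≡ i
  member-grp i k = proj₂ (∈-filter⁻ (λ x → grp x ≟ᶠ i) {xs = allFin v} (∈-lookup k))

  member-mono : ∀ i → member i Preserves _<ᶠ_ ⟶ _<ᶠ_
  member-mono i = AllPairs-lookup< (AllPairsₚ.filter⁺ (λ x → grp x ≟ᶠ i) allFin-sorted)
    where
    allFin-sorted : AllPairs _<ᶠ_ (allFin v)
    allFin-sorted = AllPairsₚ.tabulate⁺-< (λ x<y → x<y)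

  rankIn : ∀ i y → grp y ≡ i → Fin (gsize grp i)
  rankIn i y y∈Gᵢ = index (∈-filter⁺ (λ x → grp x ≟ᶠ i) (∈-allFin y) y∈Gᵢ)

  member-rankIn : ∀ i y (y∈Gᵢ : grp y ≡ i) → member i (rankIn i y y∈Gᵢ) ≡ y
  member-rankIn i y y∈Gᵢ = sym (Anyₚ.lookup-index (∈-filter⁺ (λ x → grp x ≟ᶠ i) (∈-allFin y) y∈Gᵢ))

  rankIn-member : ∀ i k (k∈Gᵢ : grp (member i k) ≡ i) → rankIn i (member i k) k∈Gᵢ ≡ k
  rankIn-member i k k∈Gᵢ = mono⇒injective (member i) (member-mono i) (member-rankIn i (member i k) k∈Gᵢ)

  rankIn-injective : ∀ {i x y} (x∈Gᵢ : grp x ≡ i) (y∈Gᵢ : grp y ≡ i) → rankIn i x x∈Gᵢ ≡ rankIn i y y∈Gᵢ → x ≡ y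
  rankIn-injective {i} {x} {y} x∈Gᵢ y∈Gᵢ eq =
    trans (sym (member-rankIn i x x∈Gᵢ)) (trans (cong (member i) eq) (member-rankIn i y y∈Gᵢ))

  rank : ∀ y → Fin (gsize grp (grp y))
  rank y = rankIn (grp y) y refl

  ∑-by-groups : ∀ (f : Fin v → ℕ) → ∑ f ≡ ∑[ i < m ] ∑[ k < gsize grp i ] f (member i k)
  ∑-by-groups f = begin
    ∑[ y < v ] f y                                 ≡⟨ sum-cong-≗ {v} (λ y → sym (spread y)) ⟩
    ∑[ y < v ] ∑[ i < m ] (𝟙[ grp y ≟ᶠ i ] * f y)   ≡⟨ ∑-comm (λ y i → 𝟙[ grp y ≟ᶠ i ] * f y) ⟩
    ∑[ i < m ] ∑[ y < v ] (𝟙[ grp y ≟ᶠ i ] * f y)   ≡⟨ sum-cong-≗ {m} (λ i → ∑-filter (λ x → grp x ≟ᶠ i) f (λ y → y)) ⟩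
    ∑[ i < m ] sum (map f (members i))             ≡⟨ sum-cong-≗ {m} (λ i → sum-map-lookup f (members i)) ⟩
    ∑[ i < m ] ∑[ k < gsize grp i ] f (member i k) ∎
    where
    open ≡-Reasoning
    spread : ∀ y → ∑[ i < m ] (𝟙[ grp y ≟ᶠ i ] * f y) ≡ f y
    spread y = trans (∑-single _ (grp y) off) on
      where
      off : ∀ i → i ≢ grp y → 𝟙[ grp y ≟ᶠ i ] * f y ≡ 0
      off i i≢ with grp y ≟ᶠ i
      ... | yes eq = contradiction (sym eq) i≢
      ... | no  _  = refl
      on : 𝟙[ grp y ≟ᶠ grp y ] * f y ≡ f y
      on with grp y ≟ᶠ grp y
      ... | yes _   = +-identityʳ (f y)
      ... | no  ≢gy = contradiction refl ≢gy

  ∑-gsize : ∑ (gsize grp) ≡ v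
  ∑-gsize = begin
    ∑[ i < m ] gsize grp i                  ≡⟨ sum-cong-≗ {m} (λ i → sym (∑-const-1 (gsize grp i))) ⟩
    ∑[ i < m ] ∑[ k < gsize grp i ] 1       ≡⟨ ∑-by-groups (λ _ → 1) ⟨
    ∑[ y < v ] 1                            ≡⟨ ∑-const-1 v ⟩
    v                                       ∎
    where open ≡-Reasoning

  InGroup : Fin m → Fin (suc v) → Set
  InGroup i x = ∃[ y ] (x ≡ suc y × grp y ≡ i)

  InGroup-unique : ∀ {i j x} → InGroup i x → InGroup j x → i ≡ j
  InGroup-unique (_ , refl , refl) (_ , refl , refl) = refl

  -- Fin (suc v) is V ∪ {∞} with ∞ = zero; embed i carries the point set of the small
  -- design on Gᵢ ∪ {∞} onto it in order, so that triples map to triples.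
  embed : ∀ i → Fin (suc (gsize grp i)) → Fin (suc v)
  embed i zero    = zero
  embed i (suc k) = suc (member i k)

  embed-mono : ∀ i → embed i Preserves _<ᶠ_ ⟶ _<ᶠ_
  embed-mono i {zero}  {suc _} _         = s≤s z≤n
  embed-mono i {suc _} {suc _} (s≤s k<l) = s≤s (member-mono i k<l)

  embed-InGroup : ∀ i k → InGroup i (embed i (suc k))
  embed-InGroup i k = member i k , refl , member-grp i k

  embed-rank : ∀ y → embed (grp y) (suc (rank y)) ≡ suc y
  embed-rank y = cong suc (member-rankIn (grp y) y refl)

  embedT : ∀ i → Triple (suc (gsize grp i)) → Triple (suc v)
  embedT i = mapT (embed i) (embed-mono i)

  embedT-points : ∀ {i u x} → x ∈T embedT i u → x ≡ zero ⊎ InGroup i x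
  embedT-points {i} {u} x∈ with ∈-mapT⁻ (embed i) (embed-mono i) {u} x∈
  ... | zero  , _ , x≡ = inj₁ x≡
  ... | suc k , _ , refl = inj₂ (embed-InGroup i k)

  embedT-b-c : ∀ i u → InGroup i (b (embedT i u)) × InGroup i (c (embedT i u))
  embedT-b-c i u with b u | c u | a<b u | b<c u
  ... | suc k | suc l | _ | _ = embed-InGroup i k , embed-InGroup i l

  embedT-group : ∀ {i j u u'} → embedT i u ≡ embedT j u' → i ≡ j
  embedT-group {i} {j} {u} {u'} eq =
    InGroup-unique (proj₁ (embedT-b-c i u)) (subst (InGroup j) (sym (cong b eq)) (proj₁ (embedT-b-c j u')))

  embedT-injective : ∀ i {u u'} → embedT i u ≡ embedT i u' → u ≡ u'
  embedT-injective i = mapT-injective (embed i) (embed-mono i)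

-- Frames

transpose : ∀ {v m} {grp : Fin v → Fin m} → Frame113 v m grp → Frame113 v m grp
transpose F = record
  { groupsEven  = groupsEven
  ; cell        = λ r s → cell s r
  ; holesEmpty  = λ i r s r∈Bᵢ s∈Bᵢ → holesEmpty i s r s∈Bᵢ r∈Bᵢ
  ; rowProp     = colProp
  ; colProp     = rowProp
  ; transversal = λ r s → transversal s r
  ; pairOnce    = λ x y x≁y → let p , x∈y∈ , unique = pairOnce x y x≁y in
                    swap p , x∈y∈ , λ q x∈ y∈ → cong swap (unique (swap q) x∈ y∈)
  }
  where open Frame113 F

module FrameProperties {v m : ℕ} {grp : Fin v → Fin m} (F : Frame113 v m grp) where
  open Frame113 F
  open GroupEnumeration grp

  H : ℕ
  H = v / 2

  t : Fin m → ℕ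
  t = half grp

  gsize≡t+t : ∀ i → gsize grp i ≡ t i + t i
  gsize≡t+t i = begin
    gsize grp i            ≡⟨ m/n*n≡m (groupsEven i) ⟨
    t i * 2                ≡⟨ *-comm (t i) 2 ⟩
    t i + (t i + 0)        ≡⟨ cong (t i +_) (+-identityʳ (t i)) ⟩
    t i + t i              ∎
    where open ≡-Reasoning

  v≡∑t+∑t : v ≡ ∑ t + ∑ t
  v≡∑t+∑t = trans (sym ∑-gsize) (trans (sum-cong-≗ gsize≡t+t) (∑-distrib-+ t t))

  H≡∑t : H ≡ ∑ t
  H≡∑t = begin
    v / 2                  ≡⟨ cong (_/ 2) v≡∑t+∑t ⟩
    (∑ t + ∑ t) / 2        ≡⟨ cong (λ n → (∑ t + n) / 2) (+-identityʳ (∑ t)) ⟨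
    (2 * ∑ t) / 2          ≡⟨ cong (_/ 2) (*-comm 2 (∑ t)) ⟩
    (∑ t * 2) / 2          ≡⟨ m*n/n≡m (∑ t) 2 ⟩
    ∑ t                    ∎
    where open ≡-Reasoning

  v≡H+H : v ≡ H + H
  v≡H+H = trans v≡∑t+∑t (cong₂ _+_ (sym H≡∑t) (sym H≡∑t))

  bandOf : ∀ r → ∃[ i ] InBand grp i (toℕ r)
  bandOf r = Band-exists t (subst (toℕ r <_) H≡∑t (Finₚ.toℕ<n r))

  band<H : ∀ {i n} → InBand grp i n → n < H
  band<H {i} (_ , n<) = subst (_ <_) (sym H≡∑t) (<-≤-trans n< (pre≤∑ t (suc (toℕ i))))

  cell-≢ : ∀ {r s t₀ x y} → cell r s ≡ just t₀ → x ∈T t₀ → y ∈T t₀ → x ≢ y → grp x ≢ grp y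
  cell-≢ {r} {s} {t₀} eq = Transversal-≢ {φ = grp} {t₀} (transversal r s t₀ eq)

  pair-determines-cell : ∀ {r s r' s' t₀ t₁ x y} → cell r s ≡ just t₀ → cell r' s' ≡ just t₁ →
    x ∈T t₀ → y ∈T t₀ → x ∈T t₁ → y ∈T t₁ → x ≢ y → (r , s) ≡ (r' , s')
  pair-determines-cell {r} {s} {r'} {s'} {t₀} {t₁} {x} {y} eq eq' x∈t₀ y∈t₀ x∈t₁ y∈t₁ x≢y =
    trans (unique (r , s) (t₀ , eq , x∈t₀) (t₀ , eq , y∈t₀)) (sym (unique (r' , s') (t₁ , eq' , x∈t₁) (t₁ , eq' , y∈t₁)))
    where unique = proj₂ (proj₂ (pairOnce x y (cell-≢ eq x∈t₀ y∈t₀ x≢y)))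

  triple-determines-cell : ∀ {r s r' s' t₀} → cell r s ≡ just t₀ → cell r' s' ≡ just t₀ → (r , s) ≡ (r' , s')
  triple-determines-cell {t₀ = t₀} eq eq' =
    pair-determines-cell eq eq' (inj₁ refl) (inj₂ (inj₁ refl)) (inj₁ refl) (inj₂ (inj₁ refl)) (proj₁ (Transversal-id t₀))

module FrameRows {v m : ℕ} {grp : Fin v → Fin m} (F : Frame113 v m grp) where
  open Frame113 F
  open GroupEnumeration grp
  open FrameProperties F

  -- The definition of a frame does not forbid a row of band i to contain points of Gᵢ.
  -- Such a point e would have too many partners: two in that cell, two in its unique
  -- cell in each of the H − tᵢ rows outside band i, all distinct by pairOnce, and all
  -- outside Gᵢ, which has only v − gᵢ = 2 (H − tᵢ) points.
  module OwnGroupAbsent {i r₀ s₀ t₀ e} (r₀∈Bᵢ : InBand grp i (toℕ r₀)) (eq₀ : cell r₀ s₀ ≡ just t₀)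
                        (e∈t₀ : e ∈T t₀) (e∈Gᵢ : grp e ≡ i) where

    Partner : Fin H → Fin v → Set
    Partner r x = Σ (Fin H) λ s → Σ (Triple v) λ t₁ → cell r s ≡ just t₁ × e ∈T t₁ × x ∈T t₁ × x ≢ e

    partner-row : ∀ {r r' x} → Partner r x → Partner r' x → r ≡ r'
    partner-row (_ , _ , eq , e∈ , x∈ , x≢e) (_ , _ , eq' , e∈' , x∈' , _) =
      cong proj₁ (pair-determines-cell eq eq' e∈ x∈ e∈' x∈' (x≢e ∘ sym))

    partner-∉Gᵢ : ∀ {r x} → Partner r x → grp x ≢ i
    partner-∉Gᵢ (_ , _ , eq , e∈ , x∈ , x≢e) x∈Gᵢ = cell-≢ eq x∈ e∈ x≢e (trans x∈Gᵢ (sym e∈Gᵢ))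

    CellWithE : Fin H → Set
    CellWithE r = Σ (Fin H) λ s → e ∈C cell r s

    cellWithE : ∀ r → ¬ InBand grp i (toℕ r) → CellWithE r
    cellWithE r r∉Bᵢ with j , r∈Bⱼ ← bandOf r
      with s , e∈ , _ ← rowProp j r r∈Bⱼ e
                          (λ e∈Gⱼ → r∉Bᵢ (subst (λ k → InBand grp k (toℕ r)) (trans (sym e∈Gⱼ) e∈Gᵢ) r∈Bⱼ))
      = s , e∈

    partnersAt : ∀ {r} → CellWithE r → List (Fin v)
    partnersAt (_ , t₁ , _ , e∈t₁) = others t₁ e∈t₁

    partnersAt-Partner : ∀ {r} (c : CellWithE r) {x} → x ∈ partnersAt c → Partner r x
    partnersAt-Partner (s , t₁ , eq , e∈t₁) x∈ = s , t₁ , eq , e∈t₁ , others-∈ t₁ e∈t₁ x∈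

    partnersAt-Unique : ∀ {r} (c : CellWithE r) → Unique (partnersAt c)
    partnersAt-Unique (_ , t₁ , _ , e∈t₁) = others-Unique t₁ e∈t₁

    partnersAt-length : ∀ {r} (c : CellWithE r) → length (partnersAt c) ≡ 2
    partnersAt-length (_ , t₁ , _ , e∈t₁) = others-length t₁ e∈t₁

    partnersIn : ∀ r → Dec (InBand grp i (toℕ r)) → List (Fin v)
    partnersIn r (yes _)    = []
    partnersIn r (no  r∉Bᵢ) = partnersAt (cellWithE r r∉Bᵢ)

    partnersIn-Partner : ∀ r d {x} → x ∈ partnersIn r d → ¬ InBand grp i (toℕ r) × Partner r x
    partnersIn-Partner r (no r∉Bᵢ) x∈ = r∉Bᵢ , partnersAt-Partner (cellWithE r r∉Bᵢ) x∈

    partnersIn-Unique : ∀ r d → Unique (partnersIn r d)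
    partnersIn-Unique r (yes _)    = []
    partnersIn-Unique r (no  r∉Bᵢ) = partnersAt-Unique (cellWithE r r∉Bᵢ)

    partnersIn-length : ∀ r d → length (partnersIn r d) + (𝟙[ d ] + 𝟙[ d ]) ≡ 2
    partnersIn-length r (yes _)    = refl
    partnersIn-length r (no  r∉Bᵢ) = trans (+-identityʳ _) (partnersAt-length (cellWithE r r∉Bᵢ))

    inBand? : ∀ (r : Fin H) → Dec (InBand grp i (toℕ r))
    inBand? r = Band? t i (toℕ r)

    rowPartners : Fin H → List (Fin v)
    rowPartners r = partnersIn r (inBand? r)

    partners : List (Fin v)
    partners = others t₀ e∈t₀ ++ concatMap rowPartners (allFin H)

    partners-Partner : ∀ {x} → x ∈ partners → ∃[ r ] Partner r x
    partners-Partner x∈ with ∈-++⁻ (others t₀ e∈t₀) x∈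
    ... | inj₁ x∈t₀ = r₀ , s₀ , t₀ , eq₀ , e∈t₀ , others-∈ t₀ e∈t₀ x∈t₀
    ... | inj₂ x∈rows with r , x∈r ← ∈-concatMap-allFin⁻ rowPartners x∈rows =
      r , proj₂ (partnersIn-Partner r (inBand? r) x∈r)

    partners-Unique : Unique partners
    partners-Unique = AllPairs-++⁺ (others-Unique t₀ e∈t₀)
      (AllPairs-concatMap-allFin⁺ (λ r → partnersIn-Unique r (inBand? r)) across-rows) off-band
      where
      across-rows : ∀ {r r'} → r <ᶠ r' → ∀ {x y} → x ∈ rowPartners r → y ∈ partnersIn r' (inBand? r') → x ≢ y
      across-rows {r} {r'} r<r' x∈ y∈ refl =
        Finₚ.<⇒≢ r<r' (partner-row (proj₂ (partnersIn-Partner r (inBand? r) x∈)) (proj₂ (partnersIn-Partner r' (inBand? r') y∈)))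
      off-band : ∀ {x y} → x ∈ others t₀ e∈t₀ → y ∈ concatMap rowPartners (allFin H) → x ≢ y
      off-band x∈ y∈ refl with r , y∈r ← ∈-concatMap-allFin⁻ rowPartners y∈
        with r∉Bᵢ , partner ← partnersIn-Partner r (inBand? r) y∈r
        with refl ← partner-row (s₀ , t₀ , eq₀ , e∈t₀ , others-∈ t₀ e∈t₀ x∈) partner
        = r∉Bᵢ r₀∈Bᵢ

    partners-and-members-Unique : Unique (partners ++ members i)
    partners-and-members-Unique =
      AllPairs-++⁺ partners-Unique (Uniqueₚ.filter⁺ (λ x → grp x ≟ᶠ i) (Uniqueₚ.allFin⁺ v)) λ x∈ y∈ x≡y →
        partner-∉Gᵢ (proj₂ (partners-Partner x∈))
                    (trans (cong grp x≡y) (proj₂ (∈-filter⁻ (λ x → grp x ≟ᶠ i) {xs = allFin v} y∈)))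

    ∑-partners : ∑[ r < H ] length (rowPartners r) + (t i + t i) ≡ H + H
    ∑-partners = begin
      ∑ len + (t i + t i)            ≡⟨ cong (λ n → ∑ len + (n + n)) band-size ⟨
      ∑ len + (∑ 𝟙 + ∑ 𝟙)            ≡⟨ cong (∑ len +_) (∑-distrib-+ {H} 𝟙 𝟙) ⟨
      ∑ len + ∑[ r < H ] (𝟙 r + 𝟙 r) ≡⟨ ∑-distrib-+ {H} len (λ r → 𝟙 r + 𝟙 r) ⟨
      ∑[ r < H ] (len r + (𝟙 r + 𝟙 r)) ≡⟨ sum-cong-≗ {H} (λ r → partnersIn-length r (inBand? r)) ⟩
      ∑[ r < H ] (1 + 1)             ≡⟨ ∑-distrib-+ {H} (λ _ → 1) (λ _ → 1) ⟩
      ∑[ r < H ] 1 + ∑[ r < H ] 1    ≡⟨ cong₂ _+_ (∑-const-1 H) (∑-const-1 H) ⟩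
      H + H                          ∎
      where
      open ≡-Reasoning
      len 𝟙 : Fin H → ℕ
      len r = length (rowPartners r)
      𝟙 r = 𝟙[ inBand? r ]
      band-size : ∑ 𝟙 ≡ t i
      band-size = trans (cong (λ n → ∑[ r < n ] 𝟙[ Band? t i (toℕ r) ]) H≡∑t) (Band-size t i)

    absurd : ⊥
    absurd = <-irrefl refl (begin-strict
      L + (t i + t i)                       <⟨ s≤s (n≤1+n _) ⟩
      2 + L + (t i + t i)                   ≡⟨ cong₂ _+_ (cong (_+ L) (others-length t₀ e∈t₀)) (gsize≡t+t i) ⟨
      length (others t₀ e∈t₀) + L + gsize grp i
                                            ≡⟨ cong (_+ gsize grp i) (length-++ (others t₀ e∈t₀)) ⟨
      length partners + gsize grp i         ≡⟨ length-++ partners ⟨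
      length (partners ++ members i)        ≤⟨ Unique-⊆⇒length≤ partners-and-members-Unique (λ {x} _ → ∈-allFin x) ⟩
      length (allFin v)                     ≡⟨ length-tabulate (λ x → x) ⟩
      v                                     ≡⟨ v≡H+H ⟩
      H + H                                 ≡⟨ ∑-partners ⟨
      ∑[ r < H ] length (rowPartners r) + (t i + t i)
                                            ≡⟨ cong (_+ (t i + t i)) (length-concatMap-tabulate rowPartners (λ r → r)) ⟨
      L + (t i + t i)                       ∎)
      where
      open ≤-Reasoning
      L = length (concatMap rowPartners (allFin H))

  row-avoids-own-group : ∀ {i r s t₀ e} → InBand grp i (toℕ r) → cell r s ≡ just t₀ → e ∈T t₀ → grp e ≢ i
  row-avoids-own-group r∈Bᵢ eq e∈t₀ e∈Gᵢ = OwnGroupAbsent.absurd r∈Bᵢ eq e∈t₀ e∈Gᵢ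

  row-cells-disjoint : ∀ {i r s s' t₀ t₁} → InBand grp i (toℕ r) → s ≢ s' →
    cell r s ≡ just t₀ → cell r s' ≡ just t₁ → Disjoint t₀ t₁
  row-cells-disjoint {i} {r} {s} {s'} {t₀} {t₁} r∈Bᵢ s≢s' eq eq' e e∈t₀ e∈t₁ =
    s≢s' (trans (unique s (t₀ , eq , e∈t₀)) (sym (unique s' (t₁ , eq' , e∈t₁))))
    where unique = proj₂ (proj₂ (rowProp i r r∈Bᵢ e (row-avoids-own-group r∈Bᵢ eq e∈t₀)))

  row : Fin H → List (Triple (suc v))
  row r = concatMap (λ s → liftCell (cell r s)) (allFin H)

  ∈-row⁻ : ∀ {r t₁} → t₁ ∈ row r → ∃[ s ] ∃[ t₀ ] (cell r s ≡ just t₀ × t₁ ≡ sucT t₀)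
  ∈-row⁻ {r} t₁∈ with s , t₁∈s ← ∈-concatMap-allFin⁻ (λ s → liftCell (cell r s)) t₁∈ = s , ∈-liftCell⁻ (cell r s) t₁∈s

  ∈-row⁺ : ∀ {r s t₀} → cell r s ≡ just t₀ → sucT t₀ ∈ row r
  ∈-row⁺ {r} {s} eq = ∈-concatMap-allFin⁺ (λ s → liftCell (cell r s)) s (subst (λ c → sucT _ ∈ liftCell c) (sym eq) (here refl))

  row-Disjoint : ∀ {i r} → InBand grp i (toℕ r) → AllPairs Disjoint (row r)
  row-Disjoint {i} {r} r∈Bᵢ = AllPairs-concatMap-allFin⁺ (λ s → liftCell-AllPairs (cell r s)) across
    where
    across : ∀ {s s'} → s <ᶠ s' → ∀ {t₁ t₂} → t₁ ∈ liftCell (cell r s) → t₂ ∈ liftCell (cell r s') → Disjoint t₁ t₂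
    across {s} {s'} s<s' t₁∈ t₂∈
      with t₀ , eq , refl ← ∈-liftCell⁻ (cell r s) t₁∈ | t₀' , eq' , refl ← ∈-liftCell⁻ (cell r s') t₂∈ =
      mapT-Disjoint suc s≤s {t₀} {t₀'} (row-cells-disjoint r∈Bᵢ (Finₚ.<⇒≢ s<s') eq eq')

  row-points : ∀ {i r t₁ x} → InBand grp i (toℕ r) → t₁ ∈ row r → x ∈T t₁ → ∃[ y ] (x ≡ suc y × grp y ≢ i)
  row-points r∈Bᵢ t₁∈ x∈ with s , t₀ , eq , refl ← ∈-row⁻ t₁∈
    with y , y∈t₀ , refl ← ∈-mapT⁻ suc s≤s {t₀} x∈ = y , refl , row-avoids-own-group r∈Bᵢ eq y∈t₀

  row-covers : ∀ {i r y} → InBand grp i (toℕ r) → grp y ≢ i → ∃[ t₁ ] (t₁ ∈ row r × suc y ∈T t₁)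
  row-covers {i} {r} {y} r∈Bᵢ y∉Gᵢ with s , (t₀ , eq , y∈t₀) , _ ← rowProp i r r∈Bᵢ y y∉Gᵢ =
    sucT t₀ , ∈-row⁺ eq , ∈-mapT⁺ suc s≤s {t₀} y∈t₀

-- The construction

module Construction {v m : ℕ} {grp : Fin v → Fin m} (F : Frame113 v m grp)
                    (D : ∀ i → NRStarDSTS (suc (gsize grp i))) where
  open Frame113 F
  open GroupEnumeration grp
  open FrameProperties F
  open FrameRows F
  module Columns = FrameRows (transpose F)
  open Multiplicity (_≟T_ {suc v})

  column : Fin H → List (Triple (suc v))
  column = Columns.row

  smallBlocks : Fin m → List (Triple (suc v))
  smallBlocks i = map (embedT i) (NRStarDSTS.blocks (D i))

  smallClass : ∀ i → Fin (suc (gsize grp i)) → List (Triple (suc v))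
  smallClass i x = map (embedT i) (NRStarDSTS.classes (D i) x)

  frameBlocks : List (Triple (suc v))
  frameBlocks = concatMap row (allFin H)

  blocks : List (Triple (suc v))
  blocks = concatMap smallBlocks (allFin m) ++ frameBlocks

  P : Fin m → ℕ
  P i = pre t (toℕ i)

  frameLineBy : ∀ i k → Dec (k < t i) → List (Triple (suc v))
  frameLineBy i k (yes _) = extendℕ row (P i + k)
  frameLineBy i k (no  _) = extendℕ column (P i + (k ∸ t i))

  frameLine : Fin m → ℕ → List (Triple (suc v))
  frameLine i k = frameLineBy i k (k <? t i)

  classAt : ∀ i → Fin (gsize grp i) → List (Triple (suc v))
  classAt i k = smallClass i (suc k) ++ frameLine i (toℕ k)

  classes : Fin (suc v) → List (Triple (suc v))
  classes zero    = concatMap (λ i → smallClass i zero) (allFin m)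
  classes (suc y) = classAt (grp y) (rank y)

  data Line : Set where
    rowLine colLine : Fin H → Line

  lineCells : Line → List (Triple (suc v))
  lineCells (rowLine r) = row r
  lineCells (colLine c) = column c

  lineIndex : Line → Fin H
  lineIndex (rowLine r) = r
  lineIndex (colLine c) = c

  -- Left inverse of the assignment of lines to ranks in a group.
  lineOffset : Fin m → Line → ℕ
  lineOffset i (rowLine r) = toℕ r ∸ P i
  lineOffset i (colLine c) = t i + (toℕ c ∸ P i)

  record LineView (i : Fin m) (k : ℕ) (cells : List (Triple (suc v))) : Set where
    field
      line   : Line
      inBand : InBand grp i (toℕ (lineIndex line))
      cells≡ : cells ≡ lineCells line
      offset : lineOffset i line ≡ k

  frameLineBy-view : ∀ i k → k < gsize grp i → (d : Dec (k < t i)) → LineView i k (frameLineBy i k d)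
  frameLineBy-view i k k<gᵢ (yes k<tᵢ) = record
    { line   = rowLine r
    ; inBand = subst (InBand grp i) (sym toℕr≡) (Band-offset t i k<tᵢ)
    ; cells≡ = trans (cong (extendℕ row) (sym toℕr≡)) (extendℕ-toℕ row r)
    ; offset = trans (cong (_∸ P i) toℕr≡) (m+n∸m≡n (P i) k)
    }
    where
    r = fromℕ< (band<H (Band-offset t i k<tᵢ))
    toℕr≡ = Finₚ.toℕ-fromℕ< (band<H (Band-offset t i k<tᵢ))
  frameLineBy-view i k k<gᵢ (no k≮tᵢ) = record
    { line   = colLine s
    ; inBand = subst (InBand grp i) (sym toℕs≡) (Band-offset t i k'<tᵢ)
    ; cells≡ = trans (cong (extendℕ column) (sym toℕs≡)) (extendℕ-toℕ column s)
    ; offset = trans (cong (λ n → t i + (n ∸ P i)) toℕs≡)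
                     (trans (cong (t i +_) (m+n∸m≡n (P i) (k ∸ t i))) (m+[n∸m]≡n (≮⇒≥ k≮tᵢ)))
    }
    where
    k'<tᵢ : k ∸ t i < t i
    k'<tᵢ = +-cancelˡ-< (t i) _ _ (subst (_< t i + t i) (sym (m+[n∸m]≡n (≮⇒≥ k≮tᵢ))) (subst (k <_) (gsize≡t+t i) k<gᵢ))
    s = fromℕ< (band<H (Band-offset t i k'<tᵢ))
    toℕs≡ = Finₚ.toℕ-fromℕ< (band<H (Band-offset t i k'<tᵢ))

  lineOf : ∀ i (k : Fin (gsize grp i)) → LineView i (toℕ k) (frameLine i (toℕ k))
  lineOf i k = frameLineBy-view i (toℕ k) (Finₚ.toℕ<n k) (toℕ k <? t i)

  row-unique : ∀ {t₁ r r'} → t₁ ∈ row r → t₁ ∈ row r' → r ≡ r'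
  row-unique t₁∈r t₁∈r' with _ , _ , eq , refl ← ∈-row⁻ t₁∈r | _ , _ , eq' , t₁≡ ← ∈-row⁻ t₁∈r'
    with refl ← sucT-injective t₁≡ = cong proj₁ (triple-determines-cell eq eq')

  column-unique : ∀ {t₁ s s'} → t₁ ∈ column s → t₁ ∈ column s' → s ≡ s'
  column-unique t₁∈s t₁∈s' with _ , _ , eq , refl ← Columns.∈-row⁻ t₁∈s | _ , _ , eq' , t₁≡ ← Columns.∈-row⁻ t₁∈s'
    with refl ← sucT-injective t₁≡ = cong proj₂ (triple-determines-cell eq eq')

  row∩column : ∀ {t₁ r s} → t₁ ∈ row r → t₁ ∈ column s → ∃[ t₀ ] (cell r s ≡ just t₀ × t₁ ≡ sucT t₀)
  row∩column t₁∈r t₁∈s with _ , t₀ , eq , refl ← ∈-row⁻ t₁∈r | _ , _ , eq' , t₁≡ ← Columns.∈-row⁻ t₁∈s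
    with refl ← sucT-injective t₁≡ with refl ← triple-determines-cell eq eq' = t₀ , eq , refl

  ∈-frameBlocks⁻ : ∀ {t₁} → t₁ ∈ frameBlocks → ∃[ r ] ∃[ s ] ∃[ t₀ ] (cell r s ≡ just t₀ × t₁ ≡ sucT t₀)
  ∈-frameBlocks⁻ t₁∈ with r , t₁∈r ← ∈-concatMap-allFin⁻ row t₁∈ = r , ∈-row⁻ t₁∈r

  ∈-frameBlocks⁺ : ∀ {r s t₀} → cell r s ≡ just t₀ → sucT t₀ ∈ frameBlocks
  ∈-frameBlocks⁺ {r} eq = ∈-concatMap-allFin⁺ row r (∈-row⁺ eq)

  frameBlocks-Unique : Unique frameBlocks
  frameBlocks-Unique = AllPairs-concatMap-allFin⁺ row-Unique λ r<r' t₁∈ t₂∈ t₁≡t₂ →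
    Finₚ.<⇒≢ r<r' (row-unique t₁∈ (subst (_∈ row _) (sym t₁≡t₂) t₂∈))
    where
    row-Unique : ∀ r → Unique (row r)
    row-Unique r = AllPairs-concatMap-allFin⁺ (λ s → liftCell-AllPairs (cell r s)) λ {s} {s'} s<s' t₁∈ t₂∈ t₁≡t₂ →
      Finₚ.<⇒≢ s<s' (cell-position t₁∈ (subst (_∈ liftCell (cell r s')) (sym t₁≡t₂) t₂∈))
      where
      cell-position : ∀ {s s' t₁} → t₁ ∈ liftCell (cell r s) → t₁ ∈ liftCell (cell r s') → s ≡ s'
      cell-position {s} {s'} t₁∈ t₁∈'
        with _ , eq , refl ← ∈-liftCell⁻ (cell r s) t₁∈ | _ , eq' , t₁≡ ← ∈-liftCell⁻ (cell r s') t₁∈'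
        with refl ← sucT-injective t₁≡ = cong proj₂ (triple-determines-cell eq eq')

  suc-InGroup : ∀ y → InGroup (grp y) (suc y)
  suc-InGroup y = y , refl , refl

  embedT≢cell : ∀ {r s t₀ i u} → cell r s ≡ just t₀ → embedT i u ≢ sucT t₀
  embedT≢cell {t₀ = t₀} {i} {u} eq e = cell-≢ eq (inj₂ (inj₁ refl)) (inj₂ (inj₂ refl)) (b≢c t₀)
    (trans (sym (group-of (proj₁ (embedT-b-c i u)) (cong b e))) (group-of (proj₂ (embedT-b-c i u)) (cong c e)))
    where
    group-of : ∀ {x y} → InGroup i x → x ≡ suc y → i ≡ grp y
    group-of in-i refl = InGroup-unique in-i (suc-InGroup _)

  ∈-lineCells⁻ : ∀ {ℓ t₁} → t₁ ∈ lineCells ℓ → ∃[ r ] ∃[ s ] ∃[ t₀ ] (cell r s ≡ just t₀ × t₁ ≡ sucT t₀)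
  ∈-lineCells⁻ {rowLine r} t₁∈ = r , ∈-row⁻ t₁∈
  ∈-lineCells⁻ {colLine s} t₁∈ with r , t₀ , eq , t₁≡ ← Columns.∈-row⁻ t₁∈ = r , s , t₀ , eq , t₁≡

  module _ {i : Fin m} where

    lineCells-Disjoint : ∀ ℓ → InBand grp i (toℕ (lineIndex ℓ)) → AllPairs Disjoint (lineCells ℓ)
    lineCells-Disjoint (rowLine r) = row-Disjoint
    lineCells-Disjoint (colLine s) = Columns.row-Disjoint

    lineCells-points : ∀ ℓ {t₁ x} → InBand grp i (toℕ (lineIndex ℓ)) → t₁ ∈ lineCells ℓ → x ∈T t₁ →
      ∃[ y ] (x ≡ suc y × grp y ≢ i)
    lineCells-points (rowLine r) = row-points
    lineCells-points (colLine s) = Columns.row-points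

    lineCells-covers : ∀ ℓ {y} → InBand grp i (toℕ (lineIndex ℓ)) → grp y ≢ i → ∃[ t₁ ] (t₁ ∈ lineCells ℓ × suc y ∈T t₁)
    lineCells-covers (rowLine r) = row-covers
    lineCells-covers (colLine s) = Columns.row-covers

    band-lines-disjoint : ∀ {ℓ ℓ' t₁} → InBand grp i (toℕ (lineIndex ℓ)) → InBand grp i (toℕ (lineIndex ℓ')) →
      ℓ ≢ ℓ' → t₁ ∈ lineCells ℓ → t₁ ∈ lineCells ℓ' → ⊥
    band-lines-disjoint {rowLine r} {rowLine r'} _ _ ℓ≢ℓ' t₁∈ t₁∈' = ℓ≢ℓ' (cong rowLine (row-unique t₁∈ t₁∈'))
    band-lines-disjoint {colLine s} {colLine s'} _ _ ℓ≢ℓ' t₁∈ t₁∈' = ℓ≢ℓ' (cong colLine (column-unique t₁∈ t₁∈'))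
    band-lines-disjoint {rowLine r} {colLine s} r∈Bᵢ s∈Bᵢ _ t₁∈ t₁∈' with _ , eq , _ ← row∩column t₁∈ t₁∈'
      with () ← trans (sym eq) (holesEmpty i r s r∈Bᵢ s∈Bᵢ)
    band-lines-disjoint {colLine s} {rowLine r} s∈Bᵢ r∈Bᵢ _ t₁∈ t₁∈' with _ , eq , _ ← row∩column t₁∈' t₁∈
      with () ← trans (sym eq) (holesEmpty i r s r∈Bᵢ s∈Bᵢ)

  lines-meet-once : ∀ {ℓ ℓ' t₁ t₂} → ℓ ≢ ℓ' → t₁ ∈ lineCells ℓ → t₁ ∈ lineCells ℓ' →
    t₂ ∈ lineCells ℓ → t₂ ∈ lineCells ℓ' → t₁ ≡ t₂
  lines-meet-once {rowLine r} {rowLine r'} ℓ≢ℓ' t₁∈ t₁∈' _ _ = contradiction (cong rowLine (row-unique t₁∈ t₁∈')) ℓ≢ℓ'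
  lines-meet-once {colLine s} {colLine s'} ℓ≢ℓ' t₁∈ t₁∈' _ _ = contradiction (cong colLine (column-unique t₁∈ t₁∈')) ℓ≢ℓ'
  lines-meet-once {rowLine r} {colLine s} _ t₁∈ t₁∈' t₂∈ t₂∈' = at-cell (row∩column t₁∈ t₁∈') (row∩column t₂∈ t₂∈')
    where
    at-cell : ∀ {t₁ t₂} → ∃[ t₀ ] (cell r s ≡ just t₀ × t₁ ≡ sucT t₀) →
              ∃[ t₀ ] (cell r s ≡ just t₀ × t₂ ≡ sucT t₀) → t₁ ≡ t₂
    at-cell (_ , eq , refl) (_ , eq' , refl) with refl ← trans (sym eq) eq' = refl
  lines-meet-once {colLine s} {rowLine r} ℓ≢ℓ' t₁∈ t₁∈' t₂∈ t₂∈' =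
    lines-meet-once {rowLine r} {colLine s} (ℓ≢ℓ' ∘ sym) t₁∈' t₁∈ t₂∈' t₂∈

  module _ (i : Fin m) where
    open NRStarDSTS (D i) using (nearPar; selfOrth) renaming (classes to smallClasses)

    ∈-smallClass⁻ : ∀ {x t₁} → t₁ ∈ smallClass i x → ∃[ u ] (u ∈ smallClasses x × t₁ ≡ embedT i u)
    ∈-smallClass⁻ = ∈-map⁻ (embedT i)

    smallClass-Disjoint : ∀ x → AllPairs Disjoint (smallClass i x)
    smallClass-Disjoint x = AllPairsₚ.map⁺ (AllPairs.map (λ {u} {u'} → mapT-Disjoint (embed i) (embed-mono i) {u} {u'})
                                                          (lookup⇒AllPairs (smallClasses x) (proj₁ (nearPar x))))

    smallClass-misses : ∀ x {t₁} → t₁ ∈ smallClass i x → ¬ (embed i x ∈T t₁)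
    smallClass-misses x t₁∈ x∈t₁ with u , u∈ , refl ← ∈-smallClass⁻ t₁∈ =
      proj₁ (proj₂ (nearPar x)) u u∈ (∈-mapT-reflect (embed i) (embed-mono i) {u} x∈t₁)

    smallClass-covers : ∀ x p → p ≢ x → ∃[ t₁ ] (t₁ ∈ smallClass i x × embed i p ∈T t₁)
    smallClass-covers x p p≢x with u , u∈ , p∈u ← proj₂ (proj₂ (nearPar x)) p p≢x =
      embedT i u , ∈-map⁺ (embedT i) u∈ , ∈-mapT⁺ (embed i) (embed-mono i) {u} p∈u

    smallClass₀-points : ∀ {t₁ x} → t₁ ∈ smallClass i zero → x ∈T t₁ → InGroup i x
    smallClass₀-points t₁∈ x∈t₁ with u , _ , refl ← ∈-smallClass⁻ t₁∈ with embedT-points {i} {u} x∈t₁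
    ... | inj₁ refl = contradiction x∈t₁ (smallClass-misses zero t₁∈)
    ... | inj₂ x∈Gᵢ = x∈Gᵢ

    smallClass-points : ∀ {x t₁ e} → t₁ ∈ smallClass i x → e ∈T t₁ → e ≡ zero ⊎ InGroup i e
    smallClass-points t₁∈ e∈t₁ with u , _ , refl ← ∈-smallClass⁻ t₁∈ = embedT-points {i} {u} e∈t₁

    smallClass-selfOrth : ∀ {x x' t₁ t₂} → x ≢ x' → t₁ ∈ smallClass i x → t₁ ∈ smallClass i x' →
      t₂ ∈ smallClass i x → t₂ ∈ smallClass i x' → t₁ ≡ t₂
    smallClass-selfOrth {x} {x'} x≢x' t₁∈ t₁∈' t₂∈ t₂∈'
      with u₁ , u₁∈ , refl ← ∈-smallClass⁻ t₁∈ | u₁' , u₁∈' , t₁≡ ← ∈-smallClass⁻ t₁∈'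
         | u₂ , u₂∈ , refl ← ∈-smallClass⁻ t₂∈ | u₂' , u₂∈' , t₂≡ ← ∈-smallClass⁻ t₂∈'
      with refl ← embedT-injective i t₁≡ | refl ← embedT-injective i t₂≡
      = cong (embedT i) (selfOrth x x' x≢x' u₁ u₂ u₁∈ u₁∈' u₂∈ u₂∈')

  classes-nearParallel-∞ : IsNearParallelClass zero (classes zero)
  classes-nearParallel-∞ = nearParallel
    (AllPairs-concatMap-allFin⁺ (λ i → smallClass-Disjoint i zero) λ {i} {j} i<j t₁∈ t₂∈ e e∈t₁ e∈t₂ →
      Finₚ.<⇒≢ i<j (InGroup-unique (smallClass₀-points i t₁∈ e∈t₁) (smallClass₀-points j t₂∈ e∈t₂)))
    (λ t₁ t₁∈ ∞∈t₁ → let i , t₁∈ᵢ = ∈-concatMap-allFin⁻ (λ i → smallClass i zero) t₁∈ in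
      case smallClass₀-points i t₁∈ᵢ ∞∈t₁ of λ ())
    covers
    where
    covers : ∀ x → x ≢ zero → ∃[ t₁ ] (t₁ ∈ classes zero × x ∈T t₁)
    covers zero    x≢∞ = contradiction refl x≢∞
    covers (suc y) _ with t₁ , t₁∈ , y∈t₁ ← smallClass-covers (grp y) zero (suc (rank y)) (λ ()) =
      t₁ , ∈-concatMap-allFin⁺ (λ i → smallClass i zero) (grp y) t₁∈ , subst (_∈T t₁) (embed-rank y) y∈t₁

  classAt-nearParallel : ∀ y ℓ → InBand grp (grp y) (toℕ (lineIndex ℓ)) →
    IsNearParallelClass (suc y) (smallClass (grp y) (suc (rank y)) ++ lineCells ℓ)
  classAt-nearParallel y ℓ ℓ∈B = nearParallel
    (AllPairs-++⁺ (smallClass-Disjoint i (suc k)) (lineCells-Disjoint ℓ ℓ∈B) across)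
    misses covers
    where
    i = grp y
    k = rank y
    across : ∀ {t₁ t₂} → t₁ ∈ smallClass i (suc k) → t₂ ∈ lineCells ℓ → Disjoint t₁ t₂
    across t₁∈ t₂∈ e e∈t₁ e∈t₂ with y' , refl , y'∉Gᵢ ← lineCells-points ℓ ℓ∈B t₂∈ e∈t₂
      with smallClass-points i t₁∈ e∈t₁
    ... | inj₂ (_ , refl , y'∈Gᵢ) = y'∉Gᵢ y'∈Gᵢ
    misses : ∀ t₁ → t₁ ∈ smallClass i (suc k) ++ lineCells ℓ → ¬ (suc y ∈T t₁)
    misses t₁ t₁∈ y∈t₁ with ∈-++⁻ (smallClass i (suc k)) t₁∈
    ... | inj₁ t₁∈small = smallClass-misses i (suc k) t₁∈small (subst (_∈T t₁) (sym (embed-rank y)) y∈t₁)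
    ... | inj₂ t₁∈line with _ , refl , y∉Gᵢ ← lineCells-points ℓ ℓ∈B t₁∈line y∈t₁ = y∉Gᵢ refl
    covers : ∀ x → x ≢ suc y → ∃[ t₁ ] (t₁ ∈ smallClass i (suc k) ++ lineCells ℓ × x ∈T t₁)
    covers zero     _   with t₁ , t₁∈ , ∞∈t₁ ← smallClass-covers i (suc k) zero (λ ()) = t₁ , ∈-++⁺ˡ t₁∈ , ∞∈t₁
    covers (suc y') y'≢y with grp y' ≟ᶠ i
    ... | no  y'∉Gᵢ with t₁ , t₁∈ , y'∈t₁ ← lineCells-covers ℓ ℓ∈B y'∉Gᵢ = t₁ , ∈-++⁺ʳ _ t₁∈ , y'∈t₁
    covers (suc y') y'≢y | yes y'∈Gᵢ
      with t₁ , t₁∈ , y'∈t₁ ← smallClass-covers i (suc k) (suc (rankIn i y' y'∈Gᵢ))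
                                (y'≢y ∘ cong suc ∘ rankIn-injective y'∈Gᵢ refl ∘ Finₚ.suc-injective) =
        t₁ , ∈-++⁺ˡ t₁∈ , subst (_∈T t₁) (cong suc (member-rankIn i y' y'∈Gᵢ)) y'∈t₁

  classes-nearParallel : ∀ x → IsNearParallelClass x (classes x)
  classes-nearParallel zero    = classes-nearParallel-∞
  classes-nearParallel (suc y) =
    subst (λ L → IsNearParallelClass (suc y) (smallClass (grp y) (suc (rank y)) ++ L)) (sym cells≡)
          (classAt-nearParallel y line inBand)
    where open LineView (lineOf (grp y) (rank y))

  smallClass∩lineCells : ∀ {i x} ℓ {t₁} → t₁ ∈ smallClass i x → t₁ ∈ lineCells ℓ → ⊥
  smallClass∩lineCells {i} ℓ t₁∈ t₁∈ℓ
    with u , _ , refl ← ∈-smallClass⁻ i t₁∈ | _ , _ , _ , eq , t₁≡ ← ∈-lineCells⁻ {ℓ} t₁∈ℓ =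
    embedT≢cell eq t₁≡

  smallClass-group : ∀ {i j x x' t₁} → t₁ ∈ smallClass i x → t₁ ∈ smallClass j x' → i ≡ j
  smallClass-group {i} {j} t₁∈ t₁∈' with _ , _ , refl ← ∈-smallClass⁻ i t₁∈ | _ , _ , t₁≡ ← ∈-smallClass⁻ j t₁∈' =
    embedT-group t₁≡

  lineAt : ∀ i → Fin (gsize grp i) → Line
  lineAt i k = LineView.line (lineOf i k)

  ∈-classAt⁻ : ∀ i k {t₁} → t₁ ∈ classAt i k → t₁ ∈ smallClass i (suc k) ⊎ t₁ ∈ lineCells (lineAt i k)
  ∈-classAt⁻ i k {t₁} t₁∈ with ∈-++⁻ (smallClass i (suc k)) t₁∈
  ... | inj₁ t₁∈small = inj₁ t₁∈small
  ... | inj₂ t₁∈line  = inj₂ (subst (t₁ ∈_) (LineView.cells≡ (lineOf i k)) t₁∈line)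

  classAt-same-group : ∀ i {k k' t₁} → k ≢ k' → t₁ ∈ classAt i k → t₁ ∈ classAt i k' →
    t₁ ∈ smallClass i (suc k) × t₁ ∈ smallClass i (suc k')
  classAt-same-group i {k} {k'} k≢k' t₁∈ t₁∈' with ∈-classAt⁻ i k t₁∈ | ∈-classAt⁻ i k' t₁∈'
  ... | inj₁ p | inj₁ q = p , q
  ... | inj₁ p | inj₂ q = ⊥-elim (smallClass∩lineCells (lineAt i k') p q)
  ... | inj₂ p | inj₁ q = ⊥-elim (smallClass∩lineCells (lineAt i k) q p)
  ... | inj₂ p | inj₂ q = ⊥-elim (band-lines-disjoint {ℓ = lineAt i k} {lineAt i k'} (LineView.inBand (lineOf i k))
                                     (LineView.inBand (lineOf i k')) (k≢k' ∘ lines-determine-rank) p q)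
    where
    lines-determine-rank : lineAt i k ≡ lineAt i k' → k ≡ k'
    lines-determine-rank ℓ≡ℓ' = Finₚ.toℕ-injective (trans (sym (LineView.offset (lineOf i k)))
                                  (trans (cong (lineOffset i) ℓ≡ℓ') (LineView.offset (lineOf i k'))))

  classAt-different-groups : ∀ {i j k k' t₁} → i ≢ j → t₁ ∈ classAt i k → t₁ ∈ classAt j k' →
    t₁ ∈ lineCells (lineAt i k) × t₁ ∈ lineCells (lineAt j k')
  classAt-different-groups {i} {j} {k} {k'} i≢j t₁∈ t₁∈' with ∈-classAt⁻ i k t₁∈ | ∈-classAt⁻ j k' t₁∈'
  ... | inj₁ p | inj₁ q = contradiction (smallClass-group p q) i≢j
  ... | inj₁ p | inj₂ q = ⊥-elim (smallClass∩lineCells (lineAt j k') p q)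
  ... | inj₂ p | inj₁ q = ⊥-elim (smallClass∩lineCells (lineAt i k) q p)
  ... | inj₂ p | inj₂ q = p , q


  classes-suc : ∀ {i} y (y∈Gᵢ : grp y ≡ i) → classes (suc y) ≡ classAt i (rankIn i y y∈Gᵢ)
  classes-suc y refl = refl

  classes-member : ∀ i k → classes (suc (member i k)) ≡ classAt i k
  classes-member i k = trans (classes-suc (member i k) (member-grp i k)) (cong (classAt i) (rankIn-member i k (member-grp i k)))

  classes-∞∩ : ∀ y {t₁} → t₁ ∈ classes zero → t₁ ∈ classes (suc y) →
    t₁ ∈ smallClass (grp y) zero × t₁ ∈ smallClass (grp y) (suc (rank y))
  classes-∞∩ y t₁∈ t₁∈'
    with j , t₁∈ⱼ ← ∈-concatMap-allFin⁻ (λ i → smallClass i zero) t₁∈ | ∈-classAt⁻ (grp y) (rank y) t₁∈'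
  ... | inj₁ t₁∈small = subst (λ i → _ ∈ smallClass i zero) (smallClass-group t₁∈ⱼ t₁∈small) t₁∈ⱼ , t₁∈small
  ... | inj₂ t₁∈line  = ⊥-elim (smallClass∩lineCells (lineAt (grp y) (rank y)) t₁∈ⱼ t₁∈line)

  classes-selfOrth : ∀ x y → x ≢ y → ∀ t₁ t₂ → t₁ ∈ classes x → t₁ ∈ classes y →
    t₂ ∈ classes x → t₂ ∈ classes y → t₁ ≡ t₂
  classes-selfOrth zero    zero    x≢y _ _ _ _ _ _ = contradiction refl x≢y
  classes-selfOrth zero    (suc y) _   _ _ p q p' q' =
    smallClass-selfOrth (grp y) (λ ()) (proj₁ (classes-∞∩ y p q)) (proj₂ (classes-∞∩ y p q))
                                       (proj₁ (classes-∞∩ y p' q')) (proj₂ (classes-∞∩ y p' q'))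
  classes-selfOrth (suc x) zero    x≢y t₁ t₂ p q p' q' = classes-selfOrth zero (suc x) (x≢y ∘ sym) t₁ t₂ q p q' p'
  classes-selfOrth (suc x) (suc y) x≢y t₁ t₂ p q p' q' with grp x ≟ᶠ grp y
  ... | yes x∈Gy = smallClass-selfOrth i (kx≢ky ∘ Finₚ.suc-injective)
                     (proj₁ (same p q)) (proj₂ (same p q)) (proj₁ (same p' q')) (proj₂ (same p' q'))
    where
    i  = grp y
    kx = rankIn i x x∈Gy
    kx≢ky : kx ≢ rank y
    kx≢ky = x≢y ∘ cong suc ∘ rankIn-injective x∈Gy refl
    same : ∀ {t} → t ∈ classes (suc x) → t ∈ classes (suc y) → t ∈ smallClass i (suc kx) × t ∈ smallClass i (suc (rank y))
    same {t} t∈x t∈y = classAt-same-group i kx≢ky (subst (t ∈_) (classes-suc x x∈Gy) t∈x) t∈y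
  ... | no  x≁y = lines-meet-once lines-differ (proj₁ (across p q)) (proj₂ (across p q)) (proj₁ (across p' q')) (proj₂ (across p' q'))
    where
    across : ∀ {t} → t ∈ classes (suc x) → t ∈ classes (suc y) →
      t ∈ lineCells (lineAt (grp x) (rank x)) × t ∈ lineCells (lineAt (grp y) (rank y))
    across = classAt-different-groups x≁y
    lines-differ : lineAt (grp x) (rank x) ≢ lineAt (grp y) (rank y)
    lines-differ ℓ≡ℓ' = x≁y (Band-unique t (LineView.inBand (lineOf (grp x) (rank x)))
                                 (subst (λ ℓ → InBand grp (grp y) (toℕ (lineIndex ℓ))) (sym ℓ≡ℓ')
                                        (LineView.inBand (lineOf (grp y) (rank y)))))

  ∈-blocks⁻ : ∀ {t₁} → t₁ ∈ blocks →
    (∃[ i ] ∃[ u ] (u ∈ NRStarDSTS.blocks (D i) × t₁ ≡ embedT i u)) ⊎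
    (∃[ r ] ∃[ s ] ∃[ t₀ ] (cell r s ≡ just t₀ × t₁ ≡ sucT t₀))
  ∈-blocks⁻ t₁∈ with ∈-++⁻ (concatMap smallBlocks (allFin m)) t₁∈
  ... | inj₂ t₁∈frame = inj₂ (∈-frameBlocks⁻ t₁∈frame)
  ... | inj₁ t₁∈small with i , t₁∈ᵢ ← ∈-concatMap-allFin⁻ smallBlocks t₁∈small = inj₁ (i , ∈-map⁻ (embedT i) t₁∈ᵢ)

  blocks-Unique : Unique blocks
  blocks-Unique = AllPairs-++⁺ (AllPairs-concatMap-allFin⁺ smallBlocks-Unique across-groups) frameBlocks-Unique small≢frame
    where
    smallBlocks-Unique : ∀ i → Unique (smallBlocks i)
    smallBlocks-Unique i = AllPairsₚ.map⁺ (AllPairs.map (λ u≢u' → u≢u' ∘ embedT-injective i)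
                                                         (IsSTS⇒Unique (NRStarDSTS.isSTS (D i))))
    across-groups : ∀ {i j} → i <ᶠ j → ∀ {t₁ t₂} → t₁ ∈ smallBlocks i → t₂ ∈ smallBlocks j → t₁ ≢ t₂
    across-groups {i} {j} i<j t₁∈ t₂∈ refl
      with _ , _ , refl ← ∈-map⁻ (embedT i) t₁∈ | _ , _ , t₁≡ ← ∈-map⁻ (embedT j) t₂∈ =
      Finₚ.<⇒≢ i<j (embedT-group t₁≡)
    small≢frame : ∀ {t₁ t₂} → t₁ ∈ concatMap smallBlocks (allFin m) → t₂ ∈ frameBlocks → t₁ ≢ t₂
    small≢frame t₁∈ t₂∈ refl
      with i , t₁∈ᵢ ← ∈-concatMap-allFin⁻ smallBlocks t₁∈ | _ , _ , _ , eq , t₁≡ ← ∈-frameBlocks⁻ t₂∈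
      with _ , _ , refl ← ∈-map⁻ (embedT i) t₁∈ᵢ = embedT≢cell eq t₁≡

  embedT-pair-group : ∀ {i j u u' x y} → x ≢ y →
    x ∈T embedT i u → y ∈T embedT i u → x ∈T embedT j u' → y ∈T embedT j u' → i ≡ j
  embedT-pair-group {i} {j} {u} {u'} x≢y x∈ y∈ x∈' y∈'
    with embedT-points {i} {u} x∈ | embedT-points {j} {u'} x∈' | embedT-points {i} {u} y∈ | embedT-points {j} {u'} y∈'
  ... | inj₂ x∈Gᵢ | inj₂ x∈Gⱼ | _         | _         = InGroup-unique x∈Gᵢ x∈Gⱼ
  ... | _         | _         | inj₂ y∈Gᵢ | inj₂ y∈Gⱼ = InGroup-unique y∈Gᵢ y∈Gⱼ
  ... | inj₁ refl | _         | inj₁ refl | _         = contradiction refl x≢y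
  ... | _         | inj₁ refl | _         | inj₁ refl = contradiction refl x≢y
  ... | inj₁ refl | inj₂ (_ , () , _) | _ | _
  ... | inj₂ (_ , () , _) | inj₁ refl | _ | _

  embedT-pair-block-unique : ∀ {i u u' x y} → u ∈ NRStarDSTS.blocks (D i) → u' ∈ NRStarDSTS.blocks (D i) → x ≢ y →
    x ∈T embedT i u → y ∈T embedT i u → x ∈T embedT i u' → y ∈T embedT i u' → embedT i u ≡ embedT i u'
  embedT-pair-block-unique {i} {u} {u'} u∈ u'∈ x≢y x∈ y∈ x∈' y∈'
    with p , p∈u , refl ← ∈-mapT⁻ (embed i) (embed-mono i) {u} x∈ | q , q∈u , refl ← ∈-mapT⁻ (embed i) (embed-mono i) {u} y∈ =
    cong (embedT i) (IsSTS-block-unique (NRStarDSTS.isSTS (D i)) u∈ u'∈ (x≢y ∘ cong (embed i)) p∈u q∈u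
                      (∈-mapT-reflect (embed i) (embed-mono i) {u'} x∈') (∈-mapT-reflect (embed i) (embed-mono i) {u'} y∈'))

  embedT∩cell-pair : ∀ {i u r s t₀ x y} → cell r s ≡ just t₀ → x ≢ y →
    x ∈T embedT i u → y ∈T embedT i u → x ∈T sucT t₀ → y ∈T sucT t₀ → ⊥
  embedT∩cell-pair {i} {u} {t₀ = t₀} eq x≢y x∈ y∈ x∈' y∈'
    with x' , x'∈ , refl ← ∈-mapT⁻ suc s≤s {t₀} x∈' | y' , y'∈ , refl ← ∈-mapT⁻ suc s≤s {t₀} y∈'
    with embedT-points {i} {u} x∈ | embedT-points {i} {u} y∈
  ... | inj₂ x∈Gᵢ | inj₂ y∈Gᵢ =
    cell-≢ eq x'∈ y'∈ (x≢y ∘ cong suc)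
      (trans (InGroup-unique (suc-InGroup x') x∈Gᵢ) (sym (InGroup-unique (suc-InGroup y') y∈Gᵢ)))

  cell-pair-block-unique : ∀ {r s r' s' t₀ t₀' x y} → cell r s ≡ just t₀ → cell r' s' ≡ just t₀' → x ≢ y →
    x ∈T sucT t₀ → y ∈T sucT t₀ → x ∈T sucT t₀' → y ∈T sucT t₀' → sucT t₀ ≡ sucT t₀'
  cell-pair-block-unique {t₀ = t₀} {t₀'} eq eq' x≢y x∈ y∈ x∈' y∈'
    with x' , x'∈ , refl ← ∈-mapT⁻ suc s≤s {t₀} x∈ | y' , y'∈ , refl ← ∈-mapT⁻ suc s≤s {t₀} y∈
    with refl ← pair-determines-cell eq eq' x'∈ y'∈ (∈-mapT-reflect suc s≤s {t₀'} x∈') (∈-mapT-reflect suc s≤s {t₀'} y∈')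
                                     (x≢y ∘ cong suc)
    with refl ← trans (sym eq) eq' = refl

  blocks-pair-unique : ∀ {x y} → x ≢ y → ∀ {t₁ t₂} → t₁ ∈ blocks → t₂ ∈ blocks →
    x ∈T t₁ → y ∈T t₁ → x ∈T t₂ → y ∈T t₂ → t₁ ≡ t₂
  blocks-pair-unique x≢y t₁∈ t₂∈ x∈₁ y∈₁ x∈₂ y∈₂ with ∈-blocks⁻ t₁∈ | ∈-blocks⁻ t₂∈
  ... | inj₁ (i , u , u∈ , refl) | inj₁ (j , u' , u'∈ , refl)
    with refl ← embedT-pair-group {i} {j} {u} {u'} x≢y x∈₁ y∈₁ x∈₂ y∈₂ =
    embedT-pair-block-unique u∈ u'∈ x≢y x∈₁ y∈₁ x∈₂ y∈₂
  ... | inj₁ (i , u , _ , refl) | inj₂ (_ , _ , _ , eq , refl) = ⊥-elim (embedT∩cell-pair {i} {u} eq x≢y x∈₁ y∈₁ x∈₂ y∈₂)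
  ... | inj₂ (_ , _ , _ , eq , refl) | inj₁ (i , u , _ , refl) = ⊥-elim (embedT∩cell-pair {i} {u} eq x≢y x∈₂ y∈₂ x∈₁ y∈₁)
  ... | inj₂ (_ , _ , _ , eq , refl) | inj₂ (_ , _ , _ , eq' , refl) = cell-pair-block-unique eq eq' x≢y x∈₁ y∈₁ x∈₂ y∈₂

  smallBlock-containing : ∀ i p q → p ≢ q → ∃[ t₁ ] (t₁ ∈ blocks × embed i p ∈T t₁ × embed i q ∈T t₁)
  smallBlock-containing i p q p≢q with k , (p∈ , q∈) , _ ← NRStarDSTS.isSTS (D i) p q p≢q =
    embedT i u , ∈-++⁺ˡ (∈-concatMap-allFin⁺ smallBlocks i (∈-map⁺ (embedT i) (∈-lookup k))) ,
    ∈-mapT⁺ (embed i) (embed-mono i) {u} p∈ , ∈-mapT⁺ (embed i) (embed-mono i) {u} q∈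
    where u = lookup (NRStarDSTS.blocks (D i)) k

  block-containing : ∀ x y → x ≢ y → ∃[ t₁ ] (t₁ ∈ blocks × x ∈T t₁ × y ∈T t₁)
  block-containing zero    zero    x≢y = contradiction refl x≢y
  block-containing zero    (suc y) _
    with t₁ , t₁∈ , ∞∈ , y∈ ← smallBlock-containing (grp y) zero (suc (rank y)) (λ ()) =
    t₁ , t₁∈ , ∞∈ , subst (_∈T t₁) (embed-rank y) y∈
  block-containing (suc x) zero    _
    with t₁ , t₁∈ , x∈ , ∞∈ ← smallBlock-containing (grp x) (suc (rank x)) zero (λ ()) =
    t₁ , t₁∈ , subst (_∈T t₁) (embed-rank x) x∈ , ∞∈
  block-containing (suc x) (suc y) x≢y with grp x ≟ᶠ grp y
  ... | yes x∈Gy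
    with t₁ , t₁∈ , x∈ , y∈ ← smallBlock-containing (grp y) (suc (rankIn (grp y) x x∈Gy)) (suc (rank y))
                                 (x≢y ∘ cong suc ∘ rankIn-injective x∈Gy refl ∘ Finₚ.suc-injective) =
    t₁ , t₁∈ , subst (_∈T t₁) (cong suc (member-rankIn (grp y) x x∈Gy)) x∈ , subst (_∈T t₁) (embed-rank y) y∈
  ... | no x≁y with (r , s) , ((t₀ , eq , x∈) , (_ , eq' , y∈)) , _ ← pairOnce x y x≁y with refl ← trans (sym eq) eq' =
    sucT t₀ , ∈-++⁺ʳ _ (∈-frameBlocks⁺ eq) , ∈-mapT⁺ suc s≤s {t₀} x∈ , ∈-mapT⁺ suc s≤s {t₀} y∈

  blocks-isSTS : IsSTS (suc v) blocks
  blocks-isSTS x y x≢y with t₁ , t₁∈ , x∈ , y∈ ← block-containing x y x≢y =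
    Unique⇒ExactlyOneBlock blocks-Unique (blocks-pair-unique x≢y) t₁∈ x∈ y∈

  smallClasses-↭ : ∀ i → concatMap (smallClass i) (allFin (suc (gsize grp i))) ↭ smallBlocks i ++ smallBlocks i
  smallClasses-↭ i = subst₂ _↭_ (map-concatMap (embedT i) (NRStarDSTS.classes (D i)) (allFin _))
                                (map-++ (embedT i) (NRStarDSTS.blocks (D i)) (NRStarDSTS.blocks (D i)))
                                (↭ₚ.map⁺ (embedT i) (NRStarDSTS.partition (D i)))

  frameLineBy-low : ∀ i k d → k < t i → frameLineBy i k d ≡ extendℕ row (P i + k)
  frameLineBy-low i k (yes _)   _     = refl
  frameLineBy-low i k (no  k≮t) k<t   = contradiction k<t k≮t

  frameLineBy-high : ∀ i k d → frameLineBy i (t i + k) d ≡ extendℕ column (P i + k)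
  frameLineBy-high i k (yes t+k<t) = contradiction t+k<t (m+n≮m (t i) k)
  frameLineBy-high i k (no  _)     = cong (λ n → extendℕ column (P i + n)) (m+n∸m≡n (t i) k)

  module _ (t₁ : Triple (suc v)) where

    count-columns : ∑[ s < H ] count t₁ (column s) ≡ count t₁ frameBlocks
    count-columns = begin
      ∑[ s < H ] count t₁ (column s)
        ≡⟨ sum-cong-≗ {H} (λ s → count-concatMap-tabulate t₁ (λ r → liftCell (cell r s)) (λ r → r)) ⟩
      ∑[ s < H ] ∑[ r < H ] count t₁ (liftCell (cell r s))
        ≡⟨ ∑-comm (λ s r → count t₁ (liftCell (cell r s))) ⟩
      ∑[ r < H ] ∑[ s < H ] count t₁ (liftCell (cell r s))
        ≡⟨ sum-cong-≗ {H} (λ r → count-concatMap-tabulate t₁ (λ s → liftCell (cell r s)) (λ s → s)) ⟨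
      ∑[ r < H ] count t₁ (row r)
        ≡⟨ count-concatMap-tabulate t₁ row (λ r → r) ⟨
      count t₁ frameBlocks
        ∎
      where open ≡-Reasoning

    count-frameLines-of : ∀ i → ∑[ k < gsize grp i ] count t₁ (frameLine i (toℕ k)) ≡
      ∑[ k < t i ] count t₁ (extendℕ row (P i + toℕ k)) + ∑[ k < t i ] count t₁ (extendℕ column (P i + toℕ k))
    count-frameLines-of i = begin
      ∑[ k < gsize grp i ] count t₁ (frameLine i (toℕ k))
        ≡⟨ cong (λ n → ∑[ k < n ] count t₁ (frameLine i (toℕ k))) (gsize≡t+t i) ⟩
      ∑[ k < t i + t i ] count t₁ (frameLine i (toℕ k))
        ≡⟨ ∑-split (t i) (t i) (λ k → count t₁ (frameLine i k)) ⟩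
      ∑[ k < t i ] count t₁ (frameLine i (toℕ k)) + ∑[ k < t i ] count t₁ (frameLine i (t i + toℕ k))
        ≡⟨ cong₂ _+_ (sum-cong-≗ {t i} λ k → cong (count t₁) (frameLineBy-low i (toℕ k) (toℕ k <? t i) (Finₚ.toℕ<n k)))
                     (sum-cong-≗ {t i} λ k → cong (count t₁) (frameLineBy-high i (toℕ k) (t i + toℕ k <? t i))) ⟩
      ∑[ k < t i ] count t₁ (extendℕ row (P i + toℕ k)) + ∑[ k < t i ] count t₁ (extendℕ column (P i + toℕ k))
        ∎
      where open ≡-Reasoning

    count-lines : ∀ (f : Fin H → List (Triple (suc v))) →
      ∑[ i < m ] ∑[ k < t i ] count t₁ (extendℕ f (P i + toℕ k)) ≡ ∑[ r < H ] count t₁ (f r)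
    count-lines f = begin
      ∑[ i < m ] ∑[ k < t i ] count t₁ (extendℕ f (P i + toℕ k))
        ≡⟨ ∑-bands t (λ r → count t₁ (extendℕ f r)) ⟨
      ∑[ r < ∑ t ] count t₁ (extendℕ f (toℕ r))
        ≡⟨ cong (λ n → ∑[ r < n ] count t₁ (extendℕ f (toℕ r))) H≡∑t ⟨
      ∑[ r < H ] count t₁ (extendℕ f (toℕ r))
        ≡⟨ sum-cong-≗ {H} (λ r → cong (count t₁) (extendℕ-toℕ f r)) ⟩
      ∑[ r < H ] count t₁ (f r)
        ∎
      where open ≡-Reasoning

    count-frameLines : ∑[ i < m ] ∑[ k < gsize grp i ] count t₁ (frameLine i (toℕ k)) ≡ count t₁ frameBlocks + count t₁ frameBlocks
    count-frameLines = begin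
      ∑[ i < m ] ∑[ k < gsize grp i ] count t₁ (frameLine i (toℕ k))
        ≡⟨ sum-cong-≗ {m} count-frameLines-of ⟩
      ∑[ i < m ] (∑[ k < t i ] count t₁ (extendℕ row (P i + toℕ k)) + ∑[ k < t i ] count t₁ (extendℕ column (P i + toℕ k)))
        ≡⟨ ∑-distrib-+ {m} _ _ ⟩
      ∑[ i < m ] ∑[ k < t i ] count t₁ (extendℕ row (P i + toℕ k)) +
      ∑[ i < m ] ∑[ k < t i ] count t₁ (extendℕ column (P i + toℕ k))
        ≡⟨ cong₂ _+_ (count-lines row) (count-lines column) ⟩
      ∑[ r < H ] count t₁ (row r) + ∑[ s < H ] count t₁ (column s)
        ≡⟨ cong₂ _+_ (sym (count-concatMap-tabulate t₁ row (λ r → r))) count-columns ⟩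
      count t₁ frameBlocks + count t₁ frameBlocks
        ∎
      where open ≡-Reasoning


    count-smallClasses : ∀ i → ∑[ x < suc (gsize grp i) ] count t₁ (smallClass i x) ≡
                               count t₁ (smallBlocks i) + count t₁ (smallBlocks i)
    count-smallClasses i = begin
      ∑[ x < suc (gsize grp i) ] count t₁ (smallClass i x)           ≡⟨ count-concatMap-tabulate t₁ (smallClass i) (λ x → x) ⟨
      count t₁ (concatMap (smallClass i) (allFin (suc (gsize grp i)))) ≡⟨ count-↭ t₁ (smallClasses-↭ i) ⟩
      count t₁ (smallBlocks i ++ smallBlocks i)                     ≡⟨ count-++ t₁ (smallBlocks i) (smallBlocks i) ⟩
      count t₁ (smallBlocks i) + count t₁ (smallBlocks i)           ∎
      where open ≡-Reasoning

    count-classes-by-groups : count t₁ (concatMap classes (allFin (suc v))) ≡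
      ∑[ i < m ] ∑[ x < suc (gsize grp i) ] count t₁ (smallClass i x) +
      ∑[ i < m ] ∑[ k < gsize grp i ] count t₁ (frameLine i (toℕ k))
    count-classes-by-groups = begin
      count t₁ (concatMap classes (allFin (suc v)))
        ≡⟨ count-concatMap-tabulate t₁ classes (λ x → x) ⟩
      S₀ + ∑[ y < v ] count t₁ (classes (suc y))
        ≡⟨ cong (S₀ +_) (∑-by-groups (λ y → count t₁ (classes (suc y)))) ⟩
      S₀ + ∑[ i < m ] ∑[ k < gsize grp i ] count t₁ (classes (suc (member i k)))
        ≡⟨ cong (S₀ +_) (sum-cong-≗ {m} λ i → sum-cong-≗ {gsize grp i} λ k →
              trans (cong (count t₁) (classes-member i k)) (count-++ t₁ (smallClass i (suc k)) _)) ⟩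
      S₀ + ∑[ i < m ] ∑[ k < gsize grp i ] (Sₖ i k + Lₖ i k)
        ≡⟨ cong (S₀ +_) (trans (sum-cong-≗ {m} λ i → ∑-distrib-+ (Sₖ i) (Lₖ i))
                               (∑-distrib-+ {m} (λ i → ∑ (Sₖ i)) (λ i → ∑ (Lₖ i)))) ⟩
      S₀ + (∑[ i < m ] ∑ (Sₖ i) + ∑[ i < m ] ∑ (Lₖ i))
        ≡⟨ +-assoc S₀ (∑[ i < m ] ∑ (Sₖ i)) (∑[ i < m ] ∑ (Lₖ i)) ⟨
      (S₀ + ∑[ i < m ] ∑ (Sₖ i)) + ∑[ i < m ] ∑ (Lₖ i)
        ≡⟨ cong (_+ ∑[ i < m ] ∑ (Lₖ i))
                (trans (cong (_+ ∑[ i < m ] ∑ (Sₖ i)) (count-concatMap-tabulate t₁ (λ i → smallClass i zero) (λ i → i)))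
                       (sym (∑-distrib-+ {m} (λ i → count t₁ (smallClass i zero)) (λ i → ∑ (Sₖ i))))) ⟩
      ∑[ i < m ] ∑[ x < suc (gsize grp i) ] count t₁ (smallClass i x) + ∑[ i < m ] ∑ (Lₖ i)
        ∎
      where
      open ≡-Reasoning
      S₀ = count t₁ (classes zero)
      Sₖ Lₖ : ∀ i → Fin (gsize grp i) → ℕ
      Sₖ i k = count t₁ (smallClass i (suc k))
      Lₖ i k = count t₁ (frameLine i (toℕ k))

    count-classes : count t₁ (concatMap classes (allFin (suc v))) ≡ count t₁ (blocks ++ blocks)
    count-classes = begin
      count t₁ (concatMap classes (allFin (suc v)))
        ≡⟨ count-classes-by-groups ⟩
      ∑[ i < m ] ∑[ x < suc (gsize grp i) ] count t₁ (smallClass i x) +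
      ∑[ i < m ] ∑[ k < gsize grp i ] count t₁ (frameLine i (toℕ k))
        ≡⟨ cong₂ _+_ (trans (sum-cong-≗ {m} count-smallClasses)
                            (∑-distrib-+ {m} (λ i → count t₁ (smallBlocks i)) (λ i → count t₁ (smallBlocks i))))
                     count-frameLines ⟩
      (SB + SB) + (count t₁ frameBlocks + count t₁ frameBlocks)
        ≡⟨ interchange SB SB (count t₁ frameBlocks) (count t₁ frameBlocks) ⟩
      (SB + count t₁ frameBlocks) + (SB + count t₁ frameBlocks)
        ≡⟨ cong₂ _+_ count-blocks count-blocks ⟨
      count t₁ blocks + count t₁ blocks
        ≡⟨ count-++ t₁ blocks blocks ⟨
      count t₁ (blocks ++ blocks)
        ∎
      where
      open ≡-Reasoning
      SB = ∑[ i < m ] count t₁ (smallBlocks i)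
      count-blocks : count t₁ blocks ≡ SB + count t₁ frameBlocks
      count-blocks = trans (count-++ t₁ (concatMap smallBlocks (allFin m)) frameBlocks)
                           (cong (_+ count t₁ frameBlocks) (count-concatMap-tabulate t₁ smallBlocks (λ i → i)))

  classes-partition : concatMap classes (allFin (suc v)) ↭ blocks ++ blocks
  classes-partition = count-≗⇒↭ _ _ count-classes

  nrStarDSTS : NRStarDSTS (suc v)
  nrStarDSTS = record
    { blocks    = blocks
    ; isSTS     = blocks-isSTS
    ; classes   = classes
    ; nearPar   = classes-nearParallel
    ; partition = classes-partition
    ; selfOrth  = classes-selfOrth
    }

theorem3p1 : (v m : ℕ) (grp : Fin v → Fin m) → Frame113 v m grp →
    (∀ (i : Fin m) → NRStarDSTS (gsize grp i + 1)) →
    NRStarDSTS (sum (map (gsize grp) (allFin m)) + 1)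
theorem3p1 v m grp F small = subst NRStarDSTS size (Construction.nrStarDSTS F small′)
  where
  small′ : ∀ i → NRStarDSTS (suc (gsize grp i))
  small′ i = subst NRStarDSTS (+-comm (gsize grp i) 1) (small i)
  size : suc v ≡ sum (map (gsize grp) (allFin m)) + 1
  size = trans (+-comm 1 v) (cong (_+ 1) (sym (trans (sum-map-tabulate (gsize grp) (λ i → i)) (GroupEnumeration.∑-gsize grp))))
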